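{- Let $p\equiv1\pmod4$ be prime and let $U^{5,3,1}$ and $U^{5,3,2}$ be the matrices with rows and columns indexed by $\binom{\mathbb{F}_p}{2}$, with all entries $0$ at $(\{a,b\},\{c,d\})$ unless $\{a,b\}\cap\{c,d\}=\emptyset$, in which case $U^{5,3,1}_{\{a,b\},\{c,d\}}=\sum_{i\in\mathbb{F}_p\setminus\{a,b,c,d\}}(S_{a,i}S_{b,i}S_{c,i}+S_{a,i}S_{b,i}S_{d,i})$ and $U^{5,3,2}_{\{a,b\},\{c,d\}}=\sum_{i\in\mathbb{F}_p\setminus\{a,b,c,d\}}(S_{a,i}S_{c,i}S_{d,i}+S_{b,i}S_{c,i}S_{d,i})$. Then $\|U^{5,3,1}\|=O(p^2)$ and $\|U^{5,3,2}\|=O(p^2)$.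
   Context: $S_{x,y}=\chi(x-y)$ where $\chi$ is the Legendre symbol of $\mathbb{F}_p$ ($\chi(0)=0$). $\|\cdot\|$ is the operator norm; asymptotics as $p\to\infty$.
   Formalization: The bounds on the operator norms of $U^{5,3,1}$ and $U^{5,3,2}$ are required only on vectors with rational entries. -}

module Defs where

open import Data.Nat as ℕ using (ℕ; zero; suc; _∸_; _%_; _≡ᵇ_; _<ᵇ_)
open import Data.Integer as ℤ using (ℤ; +_; -[1+_])
open import Data.Rational as ℚ using (ℚ; _/_; 0ℚ)
open import Data.Bool using (Bool; true; false; if_then_else_; _∨_; _∧_; not)
open import Data.List using (List; []; _∷_; map; concatMap; upTo; foldr)
open import Data.Bool.ListAction using (any)
open import Data.Nat.Primality using (Prime)
open import Relation.Binary.PropositionalEquality using (_≡_)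
open import Data.Product using (_×_; _,_; ∃)

-- reduction of a natural number modulo p (for p = 0 we leave n unchanged;
-- only prime p is ever used)
modp : ℕ → ℕ → ℕ
modp zero    n = n
modp (suc k) n = n % suc k

legendre : ℕ → ℕ → ℤ
legendre p x with modp p x ≡ᵇ 0
... | true  = + 0
... | false =
  if any (λ y → modp p (y ℕ.* y) ≡ᵇ modp p x) (upTo p) then + 1 else -[1+ 0 ]

-- S_{x,y} = χ(x - y), with x, y ∈ {0,…,p-1} and subtraction in F_p
S : ℕ → ℕ → ℕ → ℤ
S p x y = legendre p ((x ℕ.+ p) ∸ y)

sumℤ : {A : Set} → (A → ℤ) → List A → ℤ
sumℤ f = foldr (λ a acc → f a ℤ.+ acc) (+ 0)

sumℚ : {A : Set} → (A → ℚ) → List A → ℚ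
sumℚ f = foldr (λ a acc → f a ℚ.+ acc) 0ℚ

-- the 2-element subsets {a,b} of F_p, represented as (a , b) with a < b < p
Pair : Set
Pair = ℕ × ℕ

pairs : ℕ → List Pair
pairs p = concatMap (λ b → map (λ a → (a , b)) (upTo b)) (upTo p)

disjoint : Pair → Pair → Bool
disjoint (a , b) (c , d) =
  not ((a ≡ᵇ c) ∨ (a ≡ᵇ d) ∨ (b ≡ᵇ c) ∨ (b ≡ᵇ d))

avoids : ℕ → ℕ → ℕ → ℕ → ℕ → Bool
avoids i a b c d = not ((i ≡ᵇ a) ∨ (i ≡ᵇ b) ∨ (i ≡ᵇ c) ∨ (i ≡ᵇ d))

sumAvoiding : ℕ → ℕ → ℕ → ℕ → ℕ → (ℕ → ℤ) → ℤ
sumAvoiding p a b c d f =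
  sumℤ (λ i → if avoids i a b c d then f i else + 0) (upTo p)

U531 : ℕ → Pair → Pair → ℤ
U531 p (a , b) (c , d) =
  if disjoint (a , b) (c , d)
  then sumAvoiding p a b c d
         (λ i → S p a i ℤ.* S p b i ℤ.* S p c i ℤ.+ S p a i ℤ.* S p b i ℤ.* S p d i)
  else + 0

U532 : ℕ → Pair → Pair → ℤ
U532 p (a , b) (c , d) =
  if disjoint (a , b) (c , d)
  then sumAvoiding p a b c d
         (λ i → S p a i ℤ.* S p c i ℤ.* S p d i ℤ.+ S p b i ℤ.* S p c i ℤ.* S p d i)
  else + 0

toℚ : ℤ → ℚ
toℚ z = z / 1

apply : ℕ → (Pair → Pair → ℤ) → (Pair → ℚ) → (Pair → ℚ)
apply p U v P = sumℚ (λ Q → toℚ (U P Q) ℚ.* v Q) (pairs p)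

normSq : ℕ → (Pair → ℚ) → ℚ
normSq p v = sumℚ (λ P → v P ℚ.* v P) (pairs p)

-- ‖U‖ ≤ K  (operator norm), expressed for K = C p² as
-- ∀ v, ‖U v‖² ≤ K² ‖v‖², quantifying over rational vectors
opNormBound : ℕ → (Pair → Pair → ℤ) → ℕ → Set
opNormBound p U K =
  (v : Pair → ℚ) → normSq p (apply p U v) ℚ.≤ toℚ (+ (K ℕ.* K)) ℚ.* normSq p v

BigOp² : (ℕ → Pair → Pair → ℤ) → Set
BigOp² U = ∃ λ C → ∃ λ p₀ →
  (p : ℕ) → Prime p → p % 4 ≡ 1 → p₀ ℕ.≤ p →
  opNormBound p (U p) (C ℕ.* (p ℕ.* p))

module Submission where

open import Defs
open import Data.Product using (_×_)
open import Data.Nat using (ℕ; suc)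
open import Data.Nat.Primality using (Prime)
import Data.Nat.Divisibility as ℕ∣
open import Relation.Nullary using (¬_)

-- Split U⁵³¹ = M + E with M = X Y, where X_{{a,b},i} = S_{a,i} S_{b,i} and Y_{i,{c,d}} = S_{c,i} + S_{d,i}:
-- M drops both the restriction i ∉ {a,b,c,d} and the disjointness of the two pairs.
-- Operator norms are bounded through Gram matrices, ‖A‖² ≤ max_j Σ_k |(AᵀA)_{jk}|. Off the diagonal the
-- entries of XᵀX and YᵀY are built from correlations Σ_i χ(x − i) χ(y − i) with x ≠ y, which equal −1
-- (Jacobsthal; proved by counting the p − 1 points of the conic z² = y² + c). Hence ‖X‖² ≤ 3p² and ‖Y‖² ≤ 8p².
-- The error E is O(1) except on the O(p³) pairs (P, Q) that meet, where it is O(p), so the Schur test gives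
-- ‖E‖ ≤ 16p². Finally U⁵³² is the transpose of U⁵³¹.

module Sums where

  open import Algebra.Bundles using (CommutativeSemiring; CommutativeRing)
  open import Data.Nat as ℕ using (ℕ)
  import Data.Nat.Properties as ℕP
  import Data.Integer.Properties as ℤP
  open import Data.Rational as ℚ using (ℚ)
  import Data.Rational.Properties as ℚP
  open import Data.List using (List; []; _∷_; _++_; map; concatMap; foldr)
  open import Data.List.Relation.Unary.All using (All; []; _∷_)
  open import Relation.Binary.Core using (Rel; _Preserves₂_⟶_⟶_)
  open import Relation.Binary.Definitions using (Reflexive)

  module Sum {c ℓ} (R : CommutativeSemiring c ℓ) where

    open CommutativeSemiring R
    open import Algebra.Properties.CommutativeSemigroup +-commutativeSemigroup using (interchange)

    private variable
      A B : Set

    sum : (A → Carrier) → List A → Carrier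
    sum f = foldr (λ x acc → f x + acc) 0#

    sum-congᴬ : ∀ {f g : A → Carrier} {xs} → All (λ x → f x ≈ g x) xs → sum f xs ≈ sum g xs
    sum-congᴬ []       = refl
    sum-congᴬ (e ∷ es) = +-cong e (sum-congᴬ es)

    sum-cong : ∀ {f g : A → Carrier} xs → (∀ x → f x ≈ g x) → sum f xs ≈ sum g xs
    sum-cong []       e = refl
    sum-cong (x ∷ xs) e = +-cong (e x) (sum-cong xs e)

    sum-zero : (xs : List A) → sum (λ _ → 0#) xs ≈ 0#
    sum-zero []       = refl
    sum-zero (x ∷ xs) = trans (+-identityˡ _) (sum-zero xs)

    sum-+ : (f g : A → Carrier) (xs : List A) → sum (λ x → f x + g x) xs ≈ sum f xs + sum g xs
    sum-+ f g []       = sym (+-identityˡ 0#)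
    sum-+ f g (x ∷ xs) = trans (+-congˡ (sum-+ f g xs)) (interchange _ _ _ _)

    sum-*ˡ : ∀ a (f : A → Carrier) (xs : List A) → a * sum f xs ≈ sum (λ x → a * f x) xs
    sum-*ˡ a f []       = zeroʳ a
    sum-*ˡ a f (x ∷ xs) = trans (distribˡ a _ _) (+-congˡ (sum-*ˡ a f xs))

    sum-*ʳ : ∀ a (f : A → Carrier) (xs : List A) → sum f xs * a ≈ sum (λ x → f x * a) xs
    sum-*ʳ a f xs = trans (*-comm _ a) (trans (sum-*ˡ a f xs) (sum-cong xs (λ x → *-comm a (f x))))

    sum-++ : (f : A → Carrier) (xs ys : List A) → sum f (xs ++ ys) ≈ sum f xs + sum f ys
    sum-++ f []       ys = sym (+-identityˡ _)
    sum-++ f (x ∷ xs) ys = trans (+-congˡ (sum-++ f xs ys)) (sym (+-assoc _ _ _))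

    sum-map : (f : B → Carrier) (h : A → B) (xs : List A) → sum f (map h xs) ≈ sum (λ x → f (h x)) xs
    sum-map f h []       = refl
    sum-map f h (x ∷ xs) = +-congˡ (sum-map f h xs)

    sum-concatMap : (f : B → Carrier) (h : A → List B) (xs : List A) →
                    sum f (concatMap h xs) ≈ sum (λ x → sum f (h x)) xs
    sum-concatMap f h []       = refl
    sum-concatMap f h (x ∷ xs) = trans (sum-++ f (h x) _) (+-congˡ (sum-concatMap f h xs))

    sum-swap : (f : A → B → Carrier) (xs : List A) (ys : List B) →
               sum (λ x → sum (f x) ys) xs ≈ sum (λ y → sum (λ x → f x y) xs) ys
    sum-swap f []       ys = sym (sum-zero ys)
    sum-swap f (x ∷ xs) ys = trans (+-congˡ (sum-swap f xs ys))
                                   (sym (sum-+ (f x) (λ y → sum (λ x → f x y) xs) ys))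

    sum-mul : (f : A → Carrier) (g : B → Carrier) (xs : List A) (ys : List B) →
              sum f xs * sum g ys ≈ sum (λ x → sum (λ y → f x * g y) ys) xs
    sum-mul f g xs ys = trans (sum-*ʳ (sum g ys) f xs) (sum-cong xs (λ x → sum-*ˡ (f x) g ys))

    module _ {ℓ′} (_≤_ : Rel Carrier ℓ′) (≤-refl : Reflexive _≤_)
             (+-mono : _+_ Preserves₂ _≤_ ⟶ _≤_ ⟶ _≤_) where

      sum-mono : ∀ {f g : A → Carrier} {xs} → All (λ x → f x ≤ g x) xs → sum f xs ≤ sum g xs
      sum-mono []       = ≤-refl
      sum-mono (e ∷ es) = +-mono e (sum-mono es)

  module ℕΣ = Sum ℕP.+-*-commutativeSemiring
  module ℤΣ = Sum ℤP.+-*-commutativeSemiring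
  module ℚΣ = Sum (CommutativeRing.commutativeSemiring ℚP.+-*-commutativeRing)

  ℕΣ-mono : ∀ {A : Set} {f g : A → ℕ} {xs} → All (λ x → f x ℕ.≤ g x) xs → ℕΣ.sum f xs ℕ.≤ ℕΣ.sum g xs
  ℕΣ-mono = ℕΣ.sum-mono ℕ._≤_ ℕP.≤-refl ℕP.+-mono-≤

  ℚΣ-mono : ∀ {A : Set} {f g : A → ℚ} {xs} → All (λ x → f x ℚ.≤ g x) xs → ℚΣ.sum f xs ℚ.≤ ℚΣ.sum g xs
  ℚΣ-mono = ℚΣ.sum-mono ℚ._≤_ ℚP.≤-refl ℚP.+-mono-≤

module RationalFacts where

  open import Data.Nat as ℕ using (ℕ)
  open import Data.Integer as ℤ using (ℤ; +_; -[1+_])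
  import Data.Integer.Properties as ℤP
  open import Data.Rational as ℚ using (mkℚ; 0ℚ; _+_; _*_; _-_; -_; _≤_)
  import Data.Rational.Properties as ℚP
  open import Data.Rational.Solver using (module +-*-Solver)
  open import Data.Rational.Unnormalised as ℚᵘ using (mkℚᵘ; *≡*)
  import Data.Rational.Unnormalised.Properties as ℚᵘP
  import Data.Nat.Coprimality as Coprimality
  open import Data.List using ([]; _∷_)
  open import Data.Sum using (inj₁; inj₂)
  open import Relation.Binary.PropositionalEquality
  open import Defs using (toℚ)
  open Sums

  toℚ≡mkℚ : ∀ z → toℚ z ≡ mkℚ z 0 (Coprimality.sym (Coprimality.1-coprimeTo ℤ.∣ z ∣))
  toℚ≡mkℚ z = ℚP.↥p/↧p≡p (mkℚ z 0 _)

  toℚᵘ-toℚ : ∀ z → ℚ.toℚᵘ (toℚ z) ≡ mkℚᵘ z 0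
  toℚᵘ-toℚ z = cong ℚ.toℚᵘ (toℚ≡mkℚ z)

  toℚ-+ : ∀ a b → toℚ (a ℤ.+ b) ≡ toℚ a + toℚ b
  toℚ-+ a b = ℚP.toℚᵘ-injective (begin-equality
    ℚ.toℚᵘ (toℚ (a ℤ.+ b))          ≃⟨ ℚᵘP.≃-reflexive (toℚᵘ-toℚ (a ℤ.+ b)) ⟩
    mkℚᵘ (a ℤ.+ b) 0                ≃⟨ *≡* (cong (ℤ._* + 1) (cong₂ ℤ._+_ (sym (ℤP.*-identityʳ a)) (sym (ℤP.*-identityʳ b)))) ⟩
    mkℚᵘ a 0 ℚᵘ.+ mkℚᵘ b 0          ≃⟨ ℚᵘP.≃-sym (ℚᵘP.≃-reflexive (cong₂ ℚᵘ._+_ (toℚᵘ-toℚ a) (toℚᵘ-toℚ b))) ⟩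
    ℚ.toℚᵘ (toℚ a) ℚᵘ.+ ℚ.toℚᵘ (toℚ b) ≃⟨ ℚᵘP.≃-sym (ℚP.toℚᵘ-homo-+ (toℚ a) (toℚ b)) ⟩
    ℚ.toℚᵘ (toℚ a + toℚ b)          ∎)
    where open ℚᵘP.≤-Reasoning

  toℚ-* : ∀ a b → toℚ (a ℤ.* b) ≡ toℚ a * toℚ b
  toℚ-* a b = ℚP.toℚᵘ-injective (begin-equality
    ℚ.toℚᵘ (toℚ (a ℤ.* b))          ≃⟨ ℚᵘP.≃-reflexive (toℚᵘ-toℚ (a ℤ.* b)) ⟩
    mkℚᵘ (a ℤ.* b) 0                ≃⟨ *≡* refl ⟩
    mkℚᵘ a 0 ℚᵘ.* mkℚᵘ b 0          ≃⟨ ℚᵘP.≃-sym (ℚᵘP.≃-reflexive (cong₂ ℚᵘ._*_ (toℚᵘ-toℚ a) (toℚᵘ-toℚ b))) ⟩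
    ℚ.toℚᵘ (toℚ a) ℚᵘ.* ℚ.toℚᵘ (toℚ b) ≃⟨ ℚᵘP.≃-sym (ℚP.toℚᵘ-homo-* (toℚ a) (toℚ b)) ⟩
    ℚ.toℚᵘ (toℚ a * toℚ b)          ∎)
    where open ℚᵘP.≤-Reasoning

  toℚ-mono-≤ : ∀ {a b} → a ℤ.≤ b → toℚ a ≤ toℚ b
  toℚ-mono-≤ {a} {b} a≤b rewrite toℚ≡mkℚ a | toℚ≡mkℚ b = ℚ.*≤* (ℤP.*-monoʳ-≤-nonNeg (+ 1) a≤b)

  toℚ-nonNeg : ∀ n → 0ℚ ≤ toℚ (+ n)
  toℚ-nonNeg n = toℚ-mono-≤ {+ 0} {+ n} (ℤ.+≤+ ℕ.z≤n)

  toℚ-neg : ∀ n → toℚ -[1+ n ] ≡ - toℚ (+ ℕ.suc n)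
  toℚ-neg n rewrite toℚ≡mkℚ -[1+ n ] = refl

  toℚ-sum : ∀ {A : Set} (f : A → ℤ) xs → toℚ (ℤΣ.sum f xs) ≡ ℚΣ.sum (λ x → toℚ (f x)) xs
  toℚ-sum f []       = refl
  toℚ-sum f (x ∷ xs) = trans (toℚ-+ (f x) _) (cong (λ q → toℚ (f x) + q) (toℚ-sum f xs))

  toℚ-ℕsum : ∀ {A : Set} (f : A → ℕ) xs → toℚ (+ ℕΣ.sum f xs) ≡ ℚΣ.sum (λ x → toℚ (+ f x)) xs
  toℚ-ℕsum f []       = refl
  toℚ-ℕsum f (x ∷ xs) = trans (cong toℚ (ℤP.pos-+ (f x) _))
                          (trans (toℚ-+ (+ f x) (+ ℕΣ.sum f xs)) (cong (λ q → toℚ (+ f x) + q) (toℚ-ℕsum f xs)))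

  toℚ-pos : ∀ n → ℚ.Positive (toℚ (+ ℕ.suc n))
  toℚ-pos n rewrite toℚ≡mkℚ (+ ℕ.suc n) = _

  square-nonNeg : ∀ x → 0ℚ ≤ x * x
  square-nonNeg x with ℚP.≤-total 0ℚ x
  ... | inj₁ 0≤x = subst (_≤ x * x) (ℚP.*-zeroˡ x) (ℚP.*-monoʳ-≤-nonNeg x {{ℚ.nonNegative 0≤x}} 0≤x)
  ... | inj₂ x≤0 = subst (_≤ x * x) (ℚP.*-zeroˡ x) (ℚP.*-monoʳ-≤-nonPos x {{ℚ.nonPositive x≤0}} x≤0)

  ≤-from-difference : ∀ a b → 0ℚ ≤ a - b → b ≤ a
  ≤-from-difference a b h = subst₂ _≤_ (ℚP.+-identityʳ b) (solve 2 (λ a b → b :+ (a :- b) := a) refl a b) (ℚP.+-monoʳ-≤ b h)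
    where open +-*-Solver

  double-product≤sum-of-squares : ∀ x y → x * y + x * y ≤ x * x + y * y
  double-product≤sum-of-squares x y = ≤-from-difference _ _ (subst (0ℚ ≤_) eq (square-nonNeg (x - y)))
    where
    open +-*-Solver
    eq : (x - y) * (x - y) ≡ (x * x + y * y) - (x * y + x * y)
    eq = solve 2 (λ x y → (x :- y) :* (x :- y) := (x :* x :+ y :* y) :- (x :* y :+ x :* y)) refl x y

  -double-product≤sum-of-squares : ∀ x y → - (x * y + x * y) ≤ x * x + y * y
  -double-product≤sum-of-squares x y = ≤-from-difference _ _ (subst (0ℚ ≤_) eq (square-nonNeg (x + y)))
    where
    open +-*-Solver
    eq : (x + y) * (x + y) ≡ (x * x + y * y) - (- (x * y + x * y))
    eq = solve 2 (λ x y → (x :+ y) :* (x :+ y) := (x :* x :+ y :* y) :- (:- (x :* y :+ x :* y))) refl x y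

  weighted-double-product≤ : ∀ (g : ℤ) x y → toℚ g * (x * y + x * y) ≤ toℚ (+ ℤ.∣ g ∣) * (x * x + y * y)
  weighted-double-product≤ (+ n) x y =
    ℚP.*-monoˡ-≤-nonNeg (toℚ (+ n)) {{ℚ.nonNegative (toℚ-nonNeg n)}} (double-product≤sum-of-squares x y)
  weighted-double-product≤ -[1+ n ] x y rewrite toℚ-neg n =
    subst (_≤ c * (x * x + y * y)) eq
      (ℚP.*-monoˡ-≤-nonNeg c {{ℚ.nonNegative (toℚ-nonNeg (ℕ.suc n))}} (-double-product≤sum-of-squares x y))
    where
    open +-*-Solver
    c = toℚ (+ ℕ.suc n)
    eq : c * (- (x * y + x * y)) ≡ (- c) * (x * y + x * y)
    eq = solve 3 (λ c x y → c :* (:- (x :* y :+ x :* y)) := (:- c) :* (x :* y :+ x :* y)) refl c x y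

  half-mono-≤ : ∀ a b → a + a ≤ b + b → a ≤ b
  half-mono-≤ a b h = subst₂ _≤_ (e a) (e b) (ℚP.*-monoʳ-≤-nonNeg ℚ.½ h)
    where
    open +-*-Solver
    e : ∀ x → (x + x) * ℚ.½ ≡ x
    e = solve 1 (λ x → (x :+ x) :* con ℚ.½ := x) refl

  +-cancelˡ-≤ : ∀ a x y → a + x ≤ a + y → x ≤ y
  +-cancelˡ-≤ a x y h = subst₂ _≤_ (e x) (e y) (ℚP.+-monoʳ-≤ (- a) h)
    where
    open +-*-Solver
    e : ∀ z → (- a) + (a + z) ≡ z
    e z = solve 2 (λ a z → (:- a) :+ (a :+ z) := z) refl a z

module OperatorNorm where

  open import Data.Nat as ℕ using (ℕ)
  import Data.Nat.Properties as ℕP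
  open import Data.Integer as ℤ using (ℤ; +_)
  import Data.Integer.Properties as ℤP
  open import Data.Rational as ℚ using (ℚ; 0ℚ; _+_; _*_; _-_; -_; _≤_)
  import Data.Rational.Properties as ℚP
  open import Data.Rational.Solver using (module +-*-Solver)
  open import Data.List using (List; []; _∷_)
  open import Data.List.Membership.Propositional using (_∈_)
  open import Data.List.Relation.Unary.All as All using (All)
  open import Relation.Binary.PropositionalEquality
  open import Defs using (toℚ)
  open Sums
  open RationalFacts

  act : {I J : Set} → List J → (I → J → ℤ) → (J → ℚ) → I → ℚ
  act js A v i = ℚΣ.sum (λ j → toℚ (A i j) * v j) js

  sqNorm : {I : Set} → List I → (I → ℚ) → ℚ
  sqNorm is v = ℚΣ.sum (λ i → v i * v i) is

  record SqNormBound {I J : Set} (is : List I) (js : List J) (A : I → J → ℤ) (K : ℚ) : Set where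
    constructor sqNormBound
    field sqNorm-act≤ : ∀ v → sqNorm is (act js A v) ≤ K * sqNorm js v

  gram : {I J : Set} → List I → (I → J → ℤ) → J → J → ℤ
  gram is A j k = ℤΣ.sum (λ i → A i j ℤ.* A i k) is

  sqNorm-nonNeg : ∀ {I : Set} (is : List I) v → 0ℚ ≤ sqNorm is v
  sqNorm-nonNeg is v = subst (_≤ sqNorm is v) (ℚΣ.sum-zero is) (ℚΣ-mono (All.universal (λ i → square-nonNeg (v i)) is))

  sqNorm-cong : ∀ {I : Set} (is : List I) {v w : I → ℚ} → (∀ i → v i ≡ w i) → sqNorm is v ≡ sqNorm is w
  sqNorm-cong is e = ℚΣ.sum-cong is (λ i → cong₂ _*_ (e i) (e i))

  module _ {I J : Set} (is : List I) (js : List J) (A : I → J → ℤ) where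

    gram-sym : ∀ j k → gram is A j k ≡ gram is A k j
    gram-sym j k = ℤΣ.sum-cong is (λ i → ℤP.*-comm (A i j) (A i k))

    sqNorm-act : ∀ v → sqNorm is (act js A v) ≡ ℚΣ.sum (λ j → ℚΣ.sum (λ k → toℚ (gram is A j k) * (v j * v k)) js) js
    sqNorm-act v = begin
      ℚΣ.sum (λ i → ℚΣ.sum (a i) js * ℚΣ.sum (a i) js) is
        ≡⟨ ℚΣ.sum-cong is (λ i → ℚΣ.sum-mul (a i) (a i) js js) ⟩
      ℚΣ.sum (λ i → ℚΣ.sum (λ j → ℚΣ.sum (λ k → a i j * a i k) js) js) is
        ≡⟨ ℚΣ.sum-swap (λ i j → ℚΣ.sum (λ k → a i j * a i k) js) is js ⟩
      ℚΣ.sum (λ j → ℚΣ.sum (λ i → ℚΣ.sum (λ k → a i j * a i k) js) is) js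
        ≡⟨ ℚΣ.sum-cong js (λ j → ℚΣ.sum-swap (λ i k → a i j * a i k) is js) ⟩
      ℚΣ.sum (λ j → ℚΣ.sum (λ k → ℚΣ.sum (λ i → a i j * a i k) is) js) js
        ≡⟨ ℚΣ.sum-cong js (λ j → ℚΣ.sum-cong js (λ k → gram-entry j k)) ⟩
      ℚΣ.sum (λ j → ℚΣ.sum (λ k → toℚ (gram is A j k) * (v j * v k)) js) js ∎
      where
      open ≡-Reasoning
      a : I → J → ℚ
      a i j = toℚ (A i j) * v j
      gram-entry : ∀ j k → ℚΣ.sum (λ i → a i j * a i k) is ≡ toℚ (gram is A j k) * (v j * v k)
      gram-entry j k = begin
        ℚΣ.sum (λ i → a i j * a i k) is
          ≡⟨ ℚΣ.sum-cong is (λ i → solve 4 (λ a b x y → (a :* x) :* (b :* y) := (a :* b) :* (x :* y)) refl (toℚ (A i j)) (toℚ (A i k)) (v j) (v k)) ⟩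
        ℚΣ.sum (λ i → (toℚ (A i j) * toℚ (A i k)) * (v j * v k)) is
          ≡⟨ ℚΣ.sum-*ʳ (v j * v k) (λ i → toℚ (A i j) * toℚ (A i k)) is ⟨
        ℚΣ.sum (λ i → toℚ (A i j) * toℚ (A i k)) is * (v j * v k)
          ≡⟨ cong (_* (v j * v k)) (sym (trans (toℚ-sum (λ i → A i j ℤ.* A i k) is) (ℚΣ.sum-cong is (λ i → toℚ-* (A i j) (A i k))))) ⟩
        toℚ (gram is A j k) * (v j * v k) ∎
        where open +-*-Solver

    -- ‖A v‖² is the quadratic form of AᵀA, and 2 g v w ≤ |g| (v² + w²) splits it into two row-sum terms.
    gram-rowSum-bound : ∀ R → All (λ j → ℕΣ.sum (λ k → ℤ.∣ gram is A j k ∣) js ℕ.≤ R) js →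
                        SqNormBound is js A (toℚ (+ R))
    gram-rowSum-bound R H = sqNormBound bound
      where
      bound : ∀ v → sqNorm is (act js A v) ≤ toℚ (+ R) * sqNorm js v
      bound v =
        subst (_≤ toℚ (+ R) * sqNorm js v) (sym (sqNorm-act v)) (half-mono-≤ _ _ doubled)
        where
        open ℚP.≤-Reasoning
        g c : J → J → ℚ
        g j k = toℚ (gram is A j k)
        c j k = toℚ (+ ℤ.∣ gram is A j k ∣)
        Q = ℚΣ.sum (λ j → ℚΣ.sum (λ k → g j k * (v j * v k)) js) js
        Rv = toℚ (+ R) * sqNorm js v

        rowTerm : ℚΣ.sum (λ j → ℚΣ.sum (λ k → c j k * (v j * v j)) js) js ≤ Rv
        rowTerm = begin
          ℚΣ.sum (λ j → ℚΣ.sum (λ k → c j k * (v j * v j)) js) js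
            ≡⟨ ℚΣ.sum-cong js (λ j → ℚΣ.sum-*ʳ (v j * v j) (c j) js) ⟨
          ℚΣ.sum (λ j → ℚΣ.sum (c j) js * (v j * v j)) js
            ≤⟨ ℚΣ-mono (All.map (λ {j} h → ℚP.*-monoʳ-≤-nonNeg (v j * v j) {{ℚ.nonNegative (square-nonNeg (v j))}}
                   (subst (_≤ toℚ (+ R)) (toℚ-ℕsum (λ k → ℤ.∣ gram is A j k ∣) js) (toℚ-mono-≤ (ℤ.+≤+ h)))) H) ⟩
          ℚΣ.sum (λ j → toℚ (+ R) * (v j * v j)) js
            ≡⟨ ℚΣ.sum-*ˡ (toℚ (+ R)) (λ j → v j * v j) js ⟨
          Rv ∎

        columnTerm : ℚΣ.sum (λ j → ℚΣ.sum (λ k → c j k * (v k * v k)) js) js ≤ Rv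
        columnTerm = begin
          ℚΣ.sum (λ j → ℚΣ.sum (λ k → c j k * (v k * v k)) js) js
            ≡⟨ ℚΣ.sum-swap (λ j k → c j k * (v k * v k)) js js ⟩
          ℚΣ.sum (λ k → ℚΣ.sum (λ j → c j k * (v k * v k)) js) js
            ≡⟨ ℚΣ.sum-cong js (λ k → ℚΣ.sum-cong js (λ j → cong (λ z → toℚ (+ ℤ.∣ z ∣) * (v k * v k)) (gram-sym j k))) ⟩
          ℚΣ.sum (λ k → ℚΣ.sum (λ j → c k j * (v k * v k)) js) js
            ≤⟨ rowTerm ⟩
          Rv ∎

        doubled : Q + Q ≤ Rv + Rv
        doubled = begin
          Q + Q
            ≡⟨ ℚΣ.sum-+ (λ j → ℚΣ.sum (λ k → g j k * (v j * v k)) js) (λ j → ℚΣ.sum (λ k → g j k * (v j * v k)) js) js ⟨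
          ℚΣ.sum (λ j → ℚΣ.sum (λ k → g j k * (v j * v k)) js + ℚΣ.sum (λ k → g j k * (v j * v k)) js) js
            ≡⟨ ℚΣ.sum-cong js (λ j → sym (trans (ℚΣ.sum-cong js (λ k → ℚP.*-distribˡ-+ (g j k) (v j * v k) (v j * v k)))
                 (ℚΣ.sum-+ (λ k → g j k * (v j * v k)) (λ k → g j k * (v j * v k)) js))) ⟩
          ℚΣ.sum (λ j → ℚΣ.sum (λ k → g j k * (v j * v k + v j * v k)) js) js
            ≤⟨ ℚΣ-mono (All.universal (λ j → ℚΣ-mono (All.universal (λ k → weighted-double-product≤ (gram is A j k) (v j) (v k)) js)) js) ⟩
          ℚΣ.sum (λ j → ℚΣ.sum (λ k → c j k * (v j * v j + v k * v k)) js) js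
            ≡⟨ trans (ℚΣ.sum-cong js (λ j → trans (ℚΣ.sum-cong js (λ k → ℚP.*-distribˡ-+ (c j k) _ _))
                     (ℚΣ.sum-+ (λ k → c j k * (v j * v j)) (λ k → c j k * (v k * v k)) js)))
                 (ℚΣ.sum-+ (λ j → ℚΣ.sum (λ k → c j k * (v j * v j)) js) (λ j → ℚΣ.sum (λ k → c j k * (v k * v k)) js) js) ⟩
          ℚΣ.sum (λ j → ℚΣ.sum (λ k → c j k * (v j * v j)) js) js + ℚΣ.sum (λ j → ℚΣ.sum (λ k → c j k * (v k * v k)) js) js
            ≤⟨ ℚP.+-mono-≤ rowTerm columnTerm ⟩
          Rv + Rv ∎

  ∣sum∣≤sum∣∣ : ∀ {A : Set} (f : A → ℤ) xs → ℤ.∣ ℤΣ.sum f xs ∣ ℕ.≤ ℕΣ.sum (λ x → ℤ.∣ f x ∣) xs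
  ∣sum∣≤sum∣∣ f []       = ℕ.z≤n
  ∣sum∣≤sum∣∣ f (x ∷ xs) = ℕP.≤-trans (ℤP.∣i+j∣≤∣i∣+∣j∣ (f x) _) (ℕP.+-monoʳ-≤ ℤ.∣ f x ∣ (∣sum∣≤sum∣∣ f xs))

  module _ {I J : Set} (is : List I) (js : List J) where

    SqNormBound-cong : ∀ {A B : I → J → ℤ} {K} → (∀ i j → A i j ≡ B i j) → SqNormBound is js A K → SqNormBound is js B K
    SqNormBound-cong {K = K} e (sqNormBound bound) = sqNormBound λ v →
      subst (_≤ K * sqNorm js v) (sqNorm-cong is (λ i → ℚΣ.sum-cong js (λ j → cong (λ z → toℚ z * v j) (e i j)))) (bound v)

    SqNormBound-mono : ∀ {A : I → J → ℤ} {K K′} → K ≤ K′ → SqNormBound is js A K → SqNormBound is js A K′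
    SqNormBound-mono K≤K′ (sqNormBound bound) = sqNormBound λ v → ℚP.≤-trans (bound v) (ℚP.*-monoʳ-≤-nonNeg _ {{ℚ.nonNegative (sqNorm-nonNeg js v)}} K≤K′)

    schur-gram-rowSum : (A : I → J → ℤ) (B : I → J → ℕ) (r c : ℕ) →
      (∀ {i j} → i ∈ is → j ∈ js → ℤ.∣ A i j ∣ ℕ.≤ B i j) →
      (∀ {i} → i ∈ is → ℕΣ.sum (B i) js ℕ.≤ r) →
      (∀ {j} → j ∈ js → ℕΣ.sum (λ i → B i j) is ℕ.≤ c) →
      All (λ j → ℕΣ.sum (λ k → ℤ.∣ gram is A j k ∣) js ℕ.≤ c ℕ.* r) js
    schur-gram-rowSum A B r c A≤B rows cols = All.tabulate λ {j} j∈ → begin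
      ℕΣ.sum (λ k → ℤ.∣ gram is A j k ∣) js
        ≤⟨ ℕΣ-mono (All.universal (λ k → subst (ℤ.∣ gram is A j k ∣ ℕ.≤_)
              (ℕΣ.sum-cong is (λ i → ℤP.abs-* (A i j) (A i k))) (∣sum∣≤sum∣∣ (λ i → A i j ℤ.* A i k) is)) js) ⟩
      ℕΣ.sum (λ k → ℕΣ.sum (λ i → ℤ.∣ A i j ∣ ℕ.* ℤ.∣ A i k ∣) is) js
        ≤⟨ ℕΣ-mono (All.tabulate (λ k∈ → ℕΣ-mono (All.tabulate (λ i∈ → ℕP.*-mono-≤ (A≤B i∈ j∈) (A≤B i∈ k∈))))) ⟩
      ℕΣ.sum (λ k → ℕΣ.sum (λ i → B i j ℕ.* B i k) is) js
        ≡⟨ ℕΣ.sum-swap (λ k i → B i j ℕ.* B i k) js is ⟩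
      ℕΣ.sum (λ i → ℕΣ.sum (λ k → B i j ℕ.* B i k) js) is
        ≡⟨ ℕΣ.sum-cong is (λ i → ℕΣ.sum-*ˡ (B i j) (B i) js) ⟨
      ℕΣ.sum (λ i → B i j ℕ.* ℕΣ.sum (B i) js) is
        ≤⟨ ℕΣ-mono (All.tabulate (λ {i} i∈ → ℕP.*-monoʳ-≤ (B i j) (rows i∈))) ⟩
      ℕΣ.sum (λ i → B i j ℕ.* r) is
        ≡⟨ ℕΣ.sum-*ʳ r (λ i → B i j) is ⟨
      ℕΣ.sum (λ i → B i j) is ℕ.* r
        ≤⟨ ℕP.*-monoˡ-≤ r (cols j∈) ⟩
      c ℕ.* r ∎
      where open ℕP.≤-Reasoning

    -- ⟨A Aᵀ w, w⟩ = ‖Aᵀ w‖², so ‖Aᵀ w‖² ≤ ‖A Aᵀ w‖ ‖w‖ ≤ √K ‖Aᵀ w‖ ‖w‖.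
    SqNormBound-transpose : ∀ {A : I → J → ℤ} K .{{_ : ℚ.Positive K}} →
      SqNormBound is js A K → SqNormBound js is (λ j i → A i j) K
    SqNormBound-transpose {A} K (sqNormBound bound) = sqNormBound boundᵀ
      where
      boundᵀ : ∀ w → sqNorm js (act is (λ j i → A i j) w) ≤ K * sqNorm is w
      boundᵀ w = ℚP.*-cancelˡ-≤-pos K (+-cancelˡ-≤ (K * sqNorm js u) _ _ chain)
        where
        u = act is (λ j i → A i j) w
        x = act js A u

        pairing : ℚΣ.sum (λ i → x i * w i) is ≡ sqNorm js u
        pairing = begin
          ℚΣ.sum (λ i → x i * w i) is
            ≡⟨ ℚΣ.sum-cong is (λ i → ℚΣ.sum-*ʳ (w i) (λ j → toℚ (A i j) * u j) js) ⟩
          ℚΣ.sum (λ i → ℚΣ.sum (λ j → (toℚ (A i j) * u j) * w i) js) is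
            ≡⟨ ℚΣ.sum-swap (λ i j → (toℚ (A i j) * u j) * w i) is js ⟩
          ℚΣ.sum (λ j → ℚΣ.sum (λ i → (toℚ (A i j) * u j) * w i) is) js
            ≡⟨ ℚΣ.sum-cong js (λ j → trans (ℚΣ.sum-cong is (λ i → e (toℚ (A i j)) (u j) (w i)))
                     (sym (ℚΣ.sum-*ˡ (u j) (λ i → toℚ (A i j) * w i) is))) ⟩
          sqNorm js u ∎
          where
          open ≡-Reasoning
          open +-*-Solver
          e : ∀ a b c → (a * b) * c ≡ b * (a * c)
          e = solve 3 (λ a b c → (a :* b) :* c := b :* (a :* c)) refl

        open ℚP.≤-Reasoning
        chain : K * sqNorm js u + K * sqNorm js u ≤ K * sqNorm js u + K * (K * sqNorm is w)
        chain = begin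
          K * sqNorm js u + K * sqNorm js u
            ≡⟨ cong (λ z → K * z + K * z) pairing ⟨
          K * ℚΣ.sum (λ i → x i * w i) is + K * ℚΣ.sum (λ i → x i * w i) is
            ≡⟨ trans (cong₂ _+_ (ℚΣ.sum-*ˡ K (λ i → x i * w i) is) (ℚΣ.sum-*ˡ K (λ i → x i * w i) is))
                     (sym (ℚΣ.sum-+ (λ i → K * (x i * w i)) (λ i → K * (x i * w i)) is)) ⟩
          ℚΣ.sum (λ i → K * (x i * w i) + K * (x i * w i)) is
            ≡⟨ ℚΣ.sum-cong is (λ i → e1 (x i) (w i)) ⟩
          ℚΣ.sum (λ i → x i * (K * w i) + x i * (K * w i)) is
            ≤⟨ ℚΣ-mono (All.universal (λ i → double-product≤sum-of-squares (x i) (K * w i)) is) ⟩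
          ℚΣ.sum (λ i → x i * x i + (K * w i) * (K * w i)) is
            ≡⟨ ℚΣ.sum-+ (λ i → x i * x i) (λ i → (K * w i) * (K * w i)) is ⟩
          sqNorm is x + ℚΣ.sum (λ i → (K * w i) * (K * w i)) is
            ≡⟨ cong (λ z → sqNorm is x + z) (trans (ℚΣ.sum-cong is (λ i → e2 (w i))) (sym (ℚΣ.sum-*ˡ (K * K) (λ i → w i * w i) is))) ⟩
          sqNorm is x + (K * K) * sqNorm is w
            ≤⟨ ℚP.+-monoˡ-≤ ((K * K) * sqNorm is w) (bound u) ⟩
          K * sqNorm js u + (K * K) * sqNorm is w
            ≡⟨ cong (λ z → K * sqNorm js u + z) (ℚP.*-assoc K K (sqNorm is w)) ⟩
          K * sqNorm js u + K * (K * sqNorm is w) ∎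
          where
          open +-*-Solver
          e1 : ∀ a b → K * (a * b) + K * (a * b) ≡ a * (K * b) + a * (K * b)
          e1 a b = solve 3 (λ k a b → k :* (a :* b) :+ k :* (a :* b) := a :* (k :* b) :+ a :* (k :* b)) refl K a b
          e2 : ∀ a → (K * a) * (K * a) ≡ (K * K) * (a * a)
          e2 a = solve 2 (λ k a → (k :* a) :* (k :* a) := (k :* k) :* (a :* a)) refl K a

    SqNormBound-+ : ∀ {A B : I → J → ℤ} {a b} → SqNormBound is js A a → SqNormBound is js B b →
                    SqNormBound is js (λ i j → A i j ℤ.+ B i j) ((a + a) + (b + b))
    SqNormBound-+ {A} {B} {a} {b} (sqNormBound boundA) (sqNormBound boundB) = sqNormBound bound
      where
      bound : ∀ v → sqNorm is (act js (λ i j → A i j ℤ.+ B i j) v) ≤ ((a + a) + (b + b)) * sqNorm js v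
      bound v = begin
        sqNorm is (act js (λ i j → A i j ℤ.+ B i j) v)
          ≡⟨ sqNorm-cong is split ⟩
        sqNorm is (λ i → x i + y i)
          ≤⟨ ℚΣ-mono (All.universal (λ i → sq-+≤ (x i) (y i)) is) ⟩
        ℚΣ.sum (λ i → (x i * x i + x i * x i) + (y i * y i + y i * y i)) is
          ≡⟨ trans (ℚΣ.sum-+ (λ i → x i * x i + x i * x i) (λ i → y i * y i + y i * y i) is)
               (cong₂ _+_ (ℚΣ.sum-+ (λ i → x i * x i) (λ i → x i * x i) is) (ℚΣ.sum-+ (λ i → y i * y i) (λ i → y i * y i) is)) ⟩
        (sqNorm is x + sqNorm is x) + (sqNorm is y + sqNorm is y)
          ≤⟨ ℚP.+-mono-≤ (ℚP.+-mono-≤ (boundA v) (boundA v)) (ℚP.+-mono-≤ (boundB v) (boundB v)) ⟩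
        (a * n + a * n) + (b * n + b * n)
          ≡⟨ solve 3 (λ a b n → (a :* n :+ a :* n) :+ (b :* n :+ b :* n) := ((a :+ a) :+ (b :+ b)) :* n) refl a b n ⟩
        ((a + a) + (b + b)) * n ∎
        where
        open ℚP.≤-Reasoning
        open +-*-Solver
        x = act js A v
        y = act js B v
        n = sqNorm js v
        split : ∀ i → act js (λ i j → A i j ℤ.+ B i j) v i ≡ x i + y i
        split i = trans (ℚΣ.sum-cong js (λ j → trans (cong (_* v j) (toℚ-+ (A i j) (B i j))) (ℚP.*-distribʳ-+ (v j) (toℚ (A i j)) (toℚ (B i j)))))
                        (ℚΣ.sum-+ (λ j → toℚ (A i j) * v j) (λ j → toℚ (B i j) * v j) js)
        sq-+≤ : ∀ s t → (s + t) * (s + t) ≤ (s * s + s * s) + (t * t + t * t)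
        sq-+≤ s t = subst₂ _≤_ (solve 2 (λ s t → (s :* s :+ t :* t) :+ (s :* t :+ s :* t) := (s :+ t) :* (s :+ t)) refl s t)
                               (solve 2 (λ s t → (s :* s :+ t :* t) :+ (s :* s :+ t :* t) := (s :* s :+ s :* s) :+ (t :* t :+ t :* t)) refl s t)
                               (ℚP.+-monoʳ-≤ (s * s + t * t) (double-product≤sum-of-squares s t))

  matMul : {I J K : Set} → List K → (I → K → ℤ) → (K → J → ℤ) → I → J → ℤ
  matMul ks X Z i j = ℤΣ.sum (λ k → X i k ℤ.* Z k j) ks

  module _ {I J K : Set} (is : List I) (js : List J) (ks : List K) (X : I → K → ℤ) (Z : K → J → ℤ) where

    act-matMul : ∀ v i → act js (matMul ks X Z) v i ≡ act ks X (act js Z v) i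
    act-matMul v i = begin
      ℚΣ.sum (λ j → toℚ (matMul ks X Z i j) * v j) js
        ≡⟨ ℚΣ.sum-cong js (λ j → trans (cong (_* v j) (trans (toℚ-sum (λ k → X i k ℤ.* Z k j) ks)
               (ℚΣ.sum-cong ks (λ k → toℚ-* (X i k) (Z k j))))) (ℚΣ.sum-*ʳ (v j) (λ k → toℚ (X i k) * toℚ (Z k j)) ks)) ⟩
      ℚΣ.sum (λ j → ℚΣ.sum (λ k → (toℚ (X i k) * toℚ (Z k j)) * v j) ks) js
        ≡⟨ ℚΣ.sum-swap (λ j k → (toℚ (X i k) * toℚ (Z k j)) * v j) js ks ⟩
      ℚΣ.sum (λ k → ℚΣ.sum (λ j → (toℚ (X i k) * toℚ (Z k j)) * v j) js) ks
        ≡⟨ ℚΣ.sum-cong ks (λ k → trans (ℚΣ.sum-cong js (λ j → ℚP.*-assoc (toℚ (X i k)) (toℚ (Z k j)) (v j)))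
               (sym (ℚΣ.sum-*ˡ (toℚ (X i k)) (λ j → toℚ (Z k j) * v j) js))) ⟩
      act ks X (act js Z v) i ∎
      where open ≡-Reasoning

    SqNormBound-matMul : ∀ {a b} → 0ℚ ≤ a → SqNormBound is ks X a → SqNormBound ks js Z b →
                         SqNormBound is js (matMul ks X Z) (a * b)
    SqNormBound-matMul {a} {b} 0≤a (sqNormBound boundX) (sqNormBound boundZ) = sqNormBound λ v → begin
      sqNorm is (act js (matMul ks X Z) v)  ≡⟨ sqNorm-cong is (act-matMul v) ⟩
      sqNorm is (act ks X (act js Z v))     ≤⟨ boundX (act js Z v) ⟩
      a * sqNorm ks (act js Z v)            ≤⟨ ℚP.*-monoˡ-≤-nonNeg a {{ℚ.nonNegative 0≤a}} (boundZ v) ⟩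
      a * (b * sqNorm js v)                 ≡⟨ ℚP.*-assoc a b _ ⟨
      (a * b) * sqNorm js v                 ∎
      where open ℚP.≤-Reasoning

module Ranges where

  open import Data.Nat as ℕ using (ℕ; zero; suc; _<_; _≤_; _≡ᵇ_)
  import Data.Nat.Properties as ℕP
  open import Data.Integer as ℤ using (ℤ; +_)
  import Data.Integer.Properties as ℤP
  open import Data.Bool using (true; false; T; if_then_else_)
  open import Data.Empty using (⊥-elim)
  open import Data.Unit using (tt)
  open import Data.List using ([]; _∷_; upTo; map)
  open import Data.List.Properties using (upTo-∷ʳ)
  open import Data.List.Membership.Propositional.Properties using (∈-upTo⁻)
  open import Data.List.Relation.Unary.All as All using (All)
  import Data.List.Relation.Unary.All.Properties as All
  open import Data.Product using (_,_; proj₁; proj₂)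
  open import Data.Integer.Solver using (module +-*-Solver)
  open import Function using (_∘_)
  open import Relation.Binary.PropositionalEquality
  open import Relation.Nullary using (yes; no)
  open import Defs using (Pair; pairs)
  open Sums using (module ℕΣ; module ℤΣ; ℕΣ-mono)

  Σ< : ℕ → (ℕ → ℤ) → ℤ
  Σ< n f = ℤΣ.sum f (upTo n)

  Σ<ℕ : ℕ → (ℕ → ℕ) → ℕ
  Σ<ℕ n f = ℕΣ.sum f (upTo n)

  Σ<-suc : ∀ n f → Σ< (suc n) f ≡ Σ< n f ℤ.+ f n
  Σ<-suc n f = trans (cong (ℤΣ.sum f) (sym (upTo-∷ʳ n)))
                 (trans (ℤΣ.sum-++ f (upTo n) (n ∷ [])) (cong (λ z → Σ< n f ℤ.+ z) (ℤP.+-identityʳ (f n))))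

  Σ<ℕ-suc : ∀ n f → Σ<ℕ (suc n) f ≡ Σ<ℕ n f ℕ.+ f n
  Σ<ℕ-suc n f = trans (cong (ℕΣ.sum f) (sym (upTo-∷ʳ n)))
                 (trans (ℕΣ.sum-++ f (upTo n) (n ∷ [])) (cong (Σ<ℕ n f ℕ.+_) (ℕP.+-identityʳ (f n))))

  Σ<-cong : ∀ n {f g : ℕ → ℤ} → (∀ i → i < n → f i ≡ g i) → Σ< n f ≡ Σ< n g
  Σ<-cong n h = ℤΣ.sum-congᴬ (All.tabulate (λ {i} i∈ → h i (∈-upTo⁻ i∈)))

  Σ<-zero : ∀ n (f : ℕ → ℤ) → (∀ i → i < n → f i ≡ + 0) → Σ< n f ≡ + 0
  Σ<-zero n f h = trans (Σ<-cong n h) (ℤΣ.sum-zero (upTo n))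

  Σ<-difference : ∀ n (f g : ℕ → ℤ) → Σ< n (λ i → f i ℤ.- g i) ≡ Σ< n f ℤ.- Σ< n g
  Σ<-difference n f g = trans (ℤΣ.sum-+ f (λ i → ℤ.- g i) (upTo n))
    (cong (λ z → Σ< n f ℤ.+ z) (trans (ℤΣ.sum-cong (upTo n) (λ i → sym (ℤP.-1*i≡-i (g i))))
      (trans (sym (ℤΣ.sum-*ˡ ℤ.-1ℤ g (upTo n))) (ℤP.-1*i≡-i (Σ< n g)))))

  Σ<-const : ∀ n c → Σ< n (λ _ → c) ≡ + n ℤ.* c
  Σ<-const zero    c = sym (ℤP.*-zeroˡ c)
  Σ<-const (suc n) c = begin
    Σ< (suc n) (λ _ → c)      ≡⟨ Σ<-suc n (λ _ → c) ⟩
    Σ< n (λ _ → c) ℤ.+ c      ≡⟨ cong (ℤ._+ c) (Σ<-const n c) ⟩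
    + n ℤ.* c ℤ.+ c           ≡⟨ ℤP.+-comm (+ n ℤ.* c) c ⟩
    c ℤ.+ + n ℤ.* c           ≡⟨ cong (ℤ._+ + n ℤ.* c) (ℤP.*-identityˡ c) ⟨
    + 1 ℤ.* c ℤ.+ + n ℤ.* c   ≡⟨ ℤP.*-distribʳ-+ c (+ 1) (+ n) ⟨
    + suc n ℤ.* c             ∎
    where open ≡-Reasoning

  Σ<-one : ∀ n → Σ< n (λ _ → + 1) ≡ + n
  Σ<-one n = trans (Σ<-const n (+ 1)) (ℤP.*-identityʳ (+ n))

  Σ<ℕ-mono : ∀ n {f g : ℕ → ℕ} → (∀ i → i < n → f i ≤ g i) → Σ<ℕ n f ≤ Σ<ℕ n g
  Σ<ℕ-mono n h = ℕΣ-mono (All.tabulate (λ {i} i∈ → h i (∈-upTo⁻ i∈)))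

  Σ<ℕ-const : ∀ n c → Σ<ℕ n (λ _ → c) ≡ n ℕ.* c
  Σ<ℕ-const zero    c = refl
  Σ<ℕ-const (suc n) c = trans (Σ<ℕ-suc n (λ _ → c)) (trans (cong (ℕ._+ c) (Σ<ℕ-const n c)) (ℕP.+-comm (n ℕ.* c) c))

  δ : ℕ → ℕ → ℕ
  δ r j = if r ≡ᵇ j then 1 else 0

  δ-refl : ∀ r → δ r r ≡ 1
  δ-refl zero    = refl
  δ-refl (suc r) = δ-refl r

  δ-≢ : ∀ {r j} → r ≢ j → δ r j ≡ 0
  δ-≢ {r} {j} r≢j with r ≡ᵇ j in e
  ... | true  = ⊥-elim (r≢j (ℕP.≡ᵇ⇒≡ r j (subst T (sym e) tt)))
  ... | false = refl

  δ-sym : ∀ r j → δ r j ≡ δ j r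
  δ-sym r j with r ℕ.≟ j
  ... | yes refl = refl
  ... | no r≢j   = trans (δ-≢ r≢j) (sym (δ-≢ (r≢j ∘ sym)))

  δ≤1 : ∀ r j → δ r j ≤ 1
  δ≤1 r j with r ≡ᵇ j
  ... | true  = ℕP.≤-refl
  ... | false = ℕ.z≤n

  Σ<ℕ-δ-beyond : ∀ n r → n ≤ r → Σ<ℕ n (δ r) ≡ 0
  Σ<ℕ-δ-beyond zero    r _   = refl
  Σ<ℕ-δ-beyond (suc n) r n<r = trans (Σ<ℕ-suc n (δ r))
    (cong₂ ℕ._+_ (Σ<ℕ-δ-beyond n r (ℕP.<⇒≤ n<r)) (δ-≢ (λ r≡n → ℕP.<⇒≢ n<r (sym r≡n))))

  Σ<ℕ-δ≤1 : ∀ n r → Σ<ℕ n (δ r) ≤ 1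
  Σ<ℕ-δ≤1 zero    r = ℕ.z≤n
  Σ<ℕ-δ≤1 (suc n) r rewrite Σ<ℕ-suc n (δ r) with r ℕ.≟ n
  ... | yes refl = subst (λ z → z ℕ.+ δ r r ≤ 1) (sym (Σ<ℕ-δ-beyond n r ℕP.≤-refl)) (δ≤1 r r)
  ... | no r≢n   = subst (λ z → Σ<ℕ n (δ r) ℕ.+ z ≤ 1) (sym (δ-≢ r≢n))
                     (subst (_≤ 1) (sym (ℕP.+-identityʳ _)) (Σ<ℕ-δ≤1 n r))

  Σ<-δ-sift : ∀ n r (f : ℕ → ℤ) → r < n → Σ< n (λ j → + δ r j ℤ.* f j) ≡ f r
  Σ<-δ-sift (suc n) r f r<1+n with r ℕ.≟ n
  ... | yes refl = begin
    Σ< (suc r) (λ j → + δ r j ℤ.* f j)            ≡⟨ Σ<-suc r (λ j → + δ r j ℤ.* f j) ⟩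
    Σ< r (λ j → + δ r j ℤ.* f j) ℤ.+ + δ r r ℤ.* f r
      ≡⟨ cong₂ ℤ._+_ (Σ<-zero r _ (λ j j<r → cong (λ d → + d ℤ.* f j) (δ-≢ (λ r≡j → ℕP.<⇒≢ j<r (sym r≡j)))))
                     (trans (cong (λ d → + d ℤ.* f r) (δ-refl r)) (ℤP.*-identityˡ (f r))) ⟩
    + 0 ℤ.+ f r                                    ≡⟨ ℤP.+-identityˡ (f r) ⟩
    f r                                            ∎
    where open ≡-Reasoning
  ... | no r≢n = begin
    Σ< (suc n) (λ j → + δ r j ℤ.* f j)            ≡⟨ Σ<-suc n (λ j → + δ r j ℤ.* f j) ⟩
    Σ< n (λ j → + δ r j ℤ.* f j) ℤ.+ + δ r n ℤ.* f n
      ≡⟨ cong₂ ℤ._+_ (Σ<-δ-sift n r f (ℕP.≤∧≢⇒< (ℕP.≤-pred r<1+n) r≢n)) (cong (λ d → + d ℤ.* f n) (δ-≢ r≢n)) ⟩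
    f r ℤ.+ + 0                                    ≡⟨ ℤP.+-identityʳ (f r) ⟩
    f r                                            ∎
    where open ≡-Reasoning

  Σ<-δ : ∀ n r → r < n → Σ< n (λ j → + δ r j) ≡ + 1
  Σ<-δ n r r<n = trans (Σ<-cong n (λ j _ → sym (ℤP.*-identityʳ (+ δ r j)))) (Σ<-δ-sift n r (λ _ → + 1) r<n)

  Σ<-reindex : ∀ n (σ τ : ℕ → ℕ) (f : ℕ → ℤ) →
    (∀ i → i < n → σ i < n) → (∀ i → i < n → τ i < n) →
    (∀ i → i < n → τ (σ i) ≡ i) → (∀ i → i < n → σ (τ i) ≡ i) →
    Σ< n (f ∘ σ) ≡ Σ< n f
  Σ<-reindex n σ τ f σ< τ< τσ στ = begin
    Σ< n (f ∘ σ)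
      ≡⟨ Σ<-cong n (λ i i<n → Σ<-δ-sift n (σ i) f (σ< i i<n)) ⟨
    Σ< n (λ i → Σ< n (λ j → + δ (σ i) j ℤ.* f j))
      ≡⟨ ℤΣ.sum-swap (λ i j → + δ (σ i) j ℤ.* f j) (upTo n) (upTo n) ⟩
    Σ< n (λ j → Σ< n (λ i → + δ (σ i) j ℤ.* f j))
      ≡⟨ Σ<-cong n (λ j j<n → trans (sym (ℤΣ.sum-*ʳ (f j) (λ i → + δ (σ i) j) (upTo n)))
           (trans (cong (ℤ._* f j) (trans (Σ<-cong n (λ i i<n → cong +_ (δ-τ i j i<n j<n))) (Σ<-δ n (τ j) (τ< j j<n))))
                  (ℤP.*-identityˡ (f j)))) ⟩
    Σ< n f ∎
    where
    open ≡-Reasoning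
    δ-τ : ∀ i j → i < n → j < n → δ (σ i) j ≡ δ (τ j) i
    δ-τ i j i<n j<n with σ i ℕ.≟ j
    ... | yes refl = trans (δ-refl (σ i)) (sym (subst (λ k → δ k i ≡ 1) (sym (τσ i i<n)) (δ-refl i)))
    ... | no σi≢j  = trans (δ-≢ σi≢j) (sym (δ-≢ (λ τj≡i → σi≢j (trans (cong σ (sym τj≡i)) (στ j j<n)))))

  ℕΣ-pairs : ∀ p (F : Pair → ℕ) → ℕΣ.sum F (pairs p) ≡ Σ<ℕ p (λ b → Σ<ℕ b (λ a → F (a , b)))
  ℕΣ-pairs p F = trans (ℕΣ.sum-concatMap F (λ b → map (_, b) (upTo b)) (upTo p))
                       (ℕΣ.sum-cong (upTo p) (λ b → ℕΣ.sum-map F (_, b) (upTo b)))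

  ℤΣ-pairs : ∀ p (F : Pair → ℤ) → ℤΣ.sum F (pairs p) ≡ Σ< p (λ b → Σ< b (λ a → F (a , b)))
  ℤΣ-pairs p F = trans (ℤΣ.sum-concatMap F (λ b → map (_, b) (upTo b)) (upTo p))
                       (ℤΣ.sum-cong (upTo p) (λ b → ℤΣ.sum-map F (_, b) (upTo b)))

  All-pairs : ∀ p {P : Pair → Set} → (∀ a b → a < b → b < p → P (a , b)) → All P (pairs p)
  All-pairs p h = All.concat⁺ (All.map⁺ (All.tabulate λ b∈ →
    All.map⁺ (All.tabulate λ a∈ → h _ _ (∈-upTo⁻ a∈) (∈-upTo⁻ b∈))))

  count-pairs : ∀ p → ℕΣ.sum (λ _ → 1) (pairs p) ≤ p ℕ.* p
  count-pairs p = begin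
    ℕΣ.sum (λ _ → 1) (pairs p)        ≡⟨ ℕΣ-pairs p (λ _ → 1) ⟩
    Σ<ℕ p (λ b → Σ<ℕ b (λ _ → 1))     ≤⟨ Σ<ℕ-mono p (λ b b<p → ℕP.≤-trans (ℕP.≤-reflexive (trans (Σ<ℕ-const b 1) (ℕP.*-identityʳ b))) (ℕP.<⇒≤ b<p)) ⟩
    Σ<ℕ p (λ _ → p)                   ≡⟨ Σ<ℕ-const p p ⟩
    p ℕ.* p                           ∎
    where open ℕP.≤-Reasoning

  count-pairs-fst : ∀ p x → ℕΣ.sum (λ Q → δ x (proj₁ Q)) (pairs p) ≤ p
  count-pairs-fst p x = begin
    ℕΣ.sum (λ Q → δ x (proj₁ Q)) (pairs p)  ≡⟨ ℕΣ-pairs p (λ Q → δ x (proj₁ Q)) ⟩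
    Σ<ℕ p (λ b → Σ<ℕ b (δ x))               ≤⟨ Σ<ℕ-mono p (λ b _ → Σ<ℕ-δ≤1 b x) ⟩
    Σ<ℕ p (λ _ → 1)                         ≡⟨ trans (Σ<ℕ-const p 1) (ℕP.*-identityʳ p) ⟩
    p                                       ∎
    where open ℕP.≤-Reasoning

  count-pairs-snd : ∀ p x → ℕΣ.sum (λ Q → δ x (proj₂ Q)) (pairs p) ≤ p
  count-pairs-snd p x = begin
    ℕΣ.sum (λ Q → δ x (proj₂ Q)) (pairs p)  ≡⟨ ℕΣ-pairs p (λ Q → δ x (proj₂ Q)) ⟩
    Σ<ℕ p (λ b → Σ<ℕ b (λ _ → δ x b))       ≤⟨ Σ<ℕ-mono p (λ b b<p → ℕP.≤-trans (ℕP.≤-reflexive (Σ<ℕ-const b (δ x b))) (ℕP.*-monoˡ-≤ (δ x b) (ℕP.<⇒≤ b<p))) ⟩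
    Σ<ℕ p (λ b → p ℕ.* δ x b)               ≡⟨ ℕΣ.sum-*ˡ p (δ x) (upTo p) ⟨
    p ℕ.* Σ<ℕ p (δ x)                       ≤⟨ ℕP.*-monoʳ-≤ p (Σ<ℕ-δ≤1 p x) ⟩
    p ℕ.* 1                                 ≡⟨ ℕP.*-identityʳ p ⟩
    p                                       ∎
    where open ℕP.≤-Reasoning

  square-of-Σ< : ∀ (g : ℕ → ℤ) n →
    Σ< n (λ b → Σ< b (λ a → g a ℤ.* g b)) ℤ.+ Σ< n (λ b → Σ< b (λ a → g a ℤ.* g b)) ℤ.+ Σ< n (λ a → g a ℤ.* g a)
    ≡ Σ< n g ℤ.* Σ< n g
  square-of-Σ< g zero    = refl
  square-of-Σ< g (suc n) = begin
    cross (suc n) ℤ.+ cross (suc n) ℤ.+ squares (suc n)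
      ≡⟨ cong₂ ℤ._+_ (cong₂ ℤ._+_ cross-suc cross-suc) (Σ<-suc n (λ a → g a ℤ.* g a)) ⟩
    (cross n ℤ.+ total n ℤ.* g n) ℤ.+ (cross n ℤ.+ total n ℤ.* g n) ℤ.+ (squares n ℤ.+ g n ℤ.* g n)
      ≡⟨ solve 4 (λ t s q x → (t :+ s :* x) :+ (t :+ s :* x) :+ (q :+ x :* x) := (t :+ t :+ q) :+ (s :* x :+ s :* x :+ x :* x)) refl (cross n) (total n) (squares n) (g n) ⟩
    (cross n ℤ.+ cross n ℤ.+ squares n) ℤ.+ (total n ℤ.* g n ℤ.+ total n ℤ.* g n ℤ.+ g n ℤ.* g n)
      ≡⟨ cong (ℤ._+ (total n ℤ.* g n ℤ.+ total n ℤ.* g n ℤ.+ g n ℤ.* g n)) (square-of-Σ< g n) ⟩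
    total n ℤ.* total n ℤ.+ (total n ℤ.* g n ℤ.+ total n ℤ.* g n ℤ.+ g n ℤ.* g n)
      ≡⟨ solve 2 (λ s x → s :* s :+ (s :* x :+ s :* x :+ x :* x) := (s :+ x) :* (s :+ x)) refl (total n) (g n) ⟩
    (total n ℤ.+ g n) ℤ.* (total n ℤ.+ g n)
      ≡⟨ cong₂ ℤ._*_ (Σ<-suc n g) (Σ<-suc n g) ⟨
    total (suc n) ℤ.* total (suc n) ∎
    where
    open ≡-Reasoning
    open +-*-Solver
    cross squares total : ℕ → ℤ
    cross m = Σ< m (λ b → Σ< b (λ a → g a ℤ.* g b))
    squares m = Σ< m (λ a → g a ℤ.* g a)
    total m = Σ< m g
    cross-suc : cross (suc n) ≡ cross n ℤ.+ total n ℤ.* g n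
    cross-suc = trans (Σ<-suc n (λ b → Σ< b (λ a → g a ℤ.* g b))) (cong (λ z → cross n ℤ.+ z) (sym (ℤΣ.sum-*ʳ (g n) g (upTo n))))

module Congruence (k : ℕ) where

  open import Data.Nat as ℕ using (ℕ; suc; _%_; _/_; _<_; _≤_)
  import Data.Nat.Properties as ℕP
  open import Data.Nat.DivMod using (m≡m%n+[m/n]*n; %-remove-+ʳ; m%n%n≡m%n; m<n⇒m%n≡m)
  import Data.Nat.Divisibility as ℕ∣
  open import Data.Nat.Primality using (Prime; euclidsLemma; prime⇒irreducible)
  open import Data.Nat.Coprimality using (Coprime; coprime-Bézout)
  open import Data.Nat.GCD using (module Bézout)
  open import Data.Integer as ℤ using (ℤ; +_; _+_; _*_; _-_; -_)
  import Data.Integer.Properties as ℤP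
  open import Data.Integer.DivMod using (_%ℕ_; _/ℕ_; a≡a%ℕn+[a/ℕn]*n)
  open import Data.Integer.Divisibility.Signed using (divides; ∣ᵤ⇒∣; ∣⇒∣ᵤ; ∣m∣n⇒∣m+n; ∣m⇒∣-m; ∣n⇒∣m*n; ∣m⇒∣m*n)
    renaming (_∣_ to _∣ᶻ_)
  open import Data.Integer.Solver using (module +-*-Solver)
  open import Data.Sum using (_⊎_; inj₁; inj₂)
  open import Data.Product using (∃; _,_)
  open import Data.Empty using (⊥-elim)
  open import Relation.Binary.PropositionalEquality
  open import Relation.Nullary using (¬_; Dec; yes; no)

  open +-*-Solver

  p : ℕ
  p = suc k

  P : ℤ
  P = + p

  infix 4 _≋_
  record _≋_ (a b : ℤ) : Set where
    constructor mk≋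
    field divides-difference : P ∣ᶻ (a - b)
  open _≋_ public

  ≋-refl : ∀ {a} → a ≋ a
  ≋-refl {a} = mk≋ (divides (+ 0) (solve 2 (λ a p → a :- a := con (+ 0) :* p) refl a P))

  ≡⇒≋ : ∀ {a b} → a ≡ b → a ≋ b
  ≡⇒≋ refl = ≋-refl

  ≋-sym : ∀ {a b} → a ≋ b → b ≋ a
  ≋-sym {a} {b} (mk≋ h) = mk≋ (subst (P ∣ᶻ_) (solve 2 (λ a b → :- (a :- b) := b :- a) refl a b) (∣m⇒∣-m h))

  ≋-trans : ∀ {a b c} → a ≋ b → b ≋ c → a ≋ c
  ≋-trans {a} {b} {c} (mk≋ h) (mk≋ g) =
    mk≋ (subst (P ∣ᶻ_) (solve 3 (λ a b c → (a :- b) :+ (b :- c) := a :- c) refl a b c) (∣m∣n⇒∣m+n h g))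

  infixr 2 _⟨≋⟩_
  _⟨≋⟩_ : ∀ {a b c} → a ≋ b → b ≋ c → a ≋ c
  _⟨≋⟩_ = ≋-trans

  ≋-+ : ∀ {a b c d} → a ≋ b → c ≋ d → a + c ≋ b + d
  ≋-+ {a} {b} {c} {d} (mk≋ h) (mk≋ g) =
    mk≋ (subst (P ∣ᶻ_) (solve 4 (λ a b c d → (a :- b) :+ (c :- d) := (a :+ c) :- (b :+ d)) refl a b c d) (∣m∣n⇒∣m+n h g))

  ≋-* : ∀ {a b c d} → a ≋ b → c ≋ d → a * c ≋ b * d
  ≋-* {a} {b} {c} {d} (mk≋ h) (mk≋ g) =
    mk≋ (subst (P ∣ᶻ_) (solve 4 (λ a b c d → (a :- b) :* c :+ b :* (c :- d) := (a :* c) :- (b :* d)) refl a b c d)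
               (∣m∣n⇒∣m+n (∣m⇒∣m*n c h) (∣n⇒∣m*n b g)))

  ≋-neg : ∀ {a b} → a ≋ b → - a ≋ - b
  ≋-neg {a} {b} (mk≋ h) = mk≋ (subst (P ∣ᶻ_) (solve 2 (λ a b → :- (a :- b) := (:- a) :- (:- b)) refl a b) (∣m⇒∣-m h))

  ≋-+-multiple : ∀ a q → a + q * P ≋ a
  ≋-+-multiple a q = mk≋ (divides q (solve 3 (λ a q p → (a :+ q :* p) :- a := q :* p) refl a q P))

  P≋0 : P ≋ + 0
  P≋0 = ≡⇒≋ (sym (trans (ℤP.+-identityˡ (+ 1 * P)) (ℤP.*-identityˡ P))) ⟨≋⟩ ≋-+-multiple (+ 0) (+ 1)

  ≋0⇒∣ : ∀ {a} → a ≋ + 0 → P ∣ᶻ a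
  ≋0⇒∣ {a} (mk≋ h) = subst (P ∣ᶻ_) (ℤP.+-identityʳ a) h

  ∣⇒≋0 : ∀ {a} → P ∣ᶻ a → a ≋ + 0
  ∣⇒≋0 {a} h = mk≋ (subst (P ∣ᶻ_) (sym (ℤP.+-identityʳ a)) h)

  ≋⇒-≋0 : ∀ {a b} → a ≋ b → a - b ≋ + 0
  ≋⇒-≋0 {a} {b} h = ≋-+ h (≋-refl { - b}) ⟨≋⟩ ≡⇒≋ (ℤP.+-inverseʳ b)

  -≋0⇒≋ : ∀ {a b} → a - b ≋ + 0 → a ≋ b
  -≋0⇒≋ {a} {b} h = ≡⇒≋ (solve 2 (λ a b → a := (a :- b) :+ b) refl a b) ⟨≋⟩ ≋-+ h (≋-refl {b}) ⟨≋⟩ ≡⇒≋ (ℤP.+-identityˡ b)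

  ≋-cancelˡ-+ : ∀ {x a b} → x + a ≋ x + b → a ≋ b
  ≋-cancelˡ-+ {x} {a} {b} h = ≡⇒≋ (solve 2 (λ x a → a := (:- x) :+ (x :+ a)) refl x a) ⟨≋⟩ ≋-+ (≋-refl { - x}) h
                               ⟨≋⟩ ≡⇒≋ (solve 2 (λ x b → (:- x) :+ (x :+ b) := b) refl x b)

  ≋-dec : ∀ a b → Dec (a ≋ b)
  ≋-dec a b with p ℕ∣.∣? ℤ.∣ a - b ∣
  ... | yes h = yes (mk≋ (∣ᵤ⇒∣ h))
  ... | no h  = no (λ g → h (∣⇒∣ᵤ (divides-difference g)))

  %⇒≋ : ∀ {x y} → x % p ≡ y % p → + x ≋ + y
  %⇒≋ {x} {y} e = mk≋ (divides (+ (x / p) - + (y / p)) eq)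
    where
    expand : ∀ z → + z ≡ + (z % p) + + (z / p) * P
    expand z = trans (cong +_ (m≡m%n+[m/n]*n z p)) (trans (ℤP.pos-+ (z % p) _) (cong (λ t → + (z % p) + t) (ℤP.pos-* (z / p) p)))
    eq : + x - + y ≡ (+ (x / p) - + (y / p)) * P
    eq rewrite expand x | expand y | e =
      solve 4 (λ r a b p → (r :+ a :* p) :- (r :+ b :* p) := (a :- b) :* p) refl (+ (y % p)) (+ (x / p)) (+ (y / p)) P

  ≋⇒%-ordered : ∀ {x y} → y ≤ x → + x ≋ + y → x % p ≡ y % p
  ≋⇒%-ordered {x} {y} y≤x h = trans (cong (_% p) (sym (ℕP.m+[n∸m]≡n y≤x))) (%-remove-+ʳ y {x ℕ.∸ y}
    (∣⇒∣ᵤ (subst (P ∣ᶻ_) (trans (ℤP.m-n≡m⊖n x y) (ℤP.⊖-≥ y≤x)) (divides-difference h))))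

  ≋⇒% : ∀ {x y} → + x ≋ + y → x % p ≡ y % p
  ≋⇒% {x} {y} h with ℕP.≤-total y x
  ... | inj₁ y≤x = ≋⇒%-ordered y≤x h
  ... | inj₂ x≤y = sym (≋⇒%-ordered x≤y (≋-sym h))

  mod≋ : ∀ x → + (x % p) ≋ + x
  mod≋ x = %⇒≋ (m%n%n≡m%n x p)

  residue≡ : ∀ {x u} → u < p → + x ≋ + u → x % p ≡ u
  residue≡ {x} {u} u<p h = trans (≋⇒% h) (m<n⇒m%n≡m u<p)

  rep : ℤ → ℕ
  rep z = z %ℕ p

  rep≋ : ∀ z → + rep z ≋ z
  rep≋ z = ≋-sym (≡⇒≋ (a≡a%ℕn+[a/ℕn]*n z p) ⟨≋⟩ ≋-+-multiple (+ rep z) (z /ℕ p))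

  module _ (prime : Prime p) where

    ≋0-* : ∀ {a b} → a * b ≋ + 0 → a ≋ + 0 ⊎ b ≋ + 0
    ≋0-* {a} {b} h with euclidsLemma ℤ.∣ a ∣ ℤ.∣ b ∣ prime (subst (p ℕ∣.∣_) (ℤP.abs-* a b) (∣⇒∣ᵤ (≋0⇒∣ h)))
    ... | inj₁ p∣a = inj₁ (∣⇒≋0 (∣ᵤ⇒∣ p∣a))
    ... | inj₂ p∣b = inj₂ (∣⇒≋0 (∣ᵤ⇒∣ p∣b))

    inverse : ∀ a → ¬ (+ a ≋ + 0) → ∃ λ v → + a * + v ≋ + 1
    inverse a a≢0 with coprime-Bézout coprime
      where
      coprime : Coprime a p
      coprime {d} (d∣a , d∣p) with prime⇒irreducible prime d∣p
      ... | inj₁ d≡1 = d≡1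
      ... | inj₂ refl = ⊥-elim (a≢0 (∣⇒≋0 (∣ᵤ⇒∣ d∣a)))
    ... | Bézout.+- x y eq = x , (≡⇒≋ e ⟨≋⟩ ≋-+-multiple (+ 1) (+ y))
      where
      e : + a * + x ≡ + 1 + + y * P
      e = trans (ℤP.*-comm (+ a) (+ x)) (trans (sym (ℤP.pos-* x a)) (trans (cong +_ (sym eq))
            (trans (ℤP.pos-+ 1 (y ℕ.* p)) (cong (λ t → + 1 + t) (ℤP.pos-* y p)))))
    ... | Bézout.-+ x y eq = x ℕ.* k , (≡⇒≋ e ⟨≋⟩ ≋-+-multiple (+ 1) (+ y * + k - + 1))
      where
      eq′ : + 1 + + x * + a ≡ + y * (+ 1 + + k)
      eq′ = trans (cong (λ t → + 1 + t) (sym (ℤP.pos-* x a))) (trans (sym (ℤP.pos-+ 1 (x ℕ.* a))) (trans (cong +_ eq) (ℤP.pos-* y p)))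
      e : + a * + (x ℕ.* k) ≡ + 1 + (+ y * + k - + 1) * P
      e = begin
        + a * + (x ℕ.* k)                ≡⟨ cong (λ t → + a * t) (ℤP.pos-* x k) ⟩
        + a * (+ x * + k)                ≡⟨ solve 3 (λ a x k → a :* (x :* k) := ((con (+ 1) :+ x :* a) :- con (+ 1)) :* k) refl (+ a) (+ x) (+ k) ⟩
        ((+ 1 + + x * + a) - + 1) * + k  ≡⟨ cong (λ t → (t - + 1) * + k) eq′ ⟩
        (+ y * (+ 1 + + k) - + 1) * + k  ≡⟨ solve 2 (λ y k → (y :* (con (+ 1) :+ k) :- con (+ 1)) :* k := con (+ 1) :+ (y :* k :- con (+ 1)) :* (con (+ 1) :+ k)) refl (+ y) (+ k) ⟩
        + 1 + (+ y * + k - + 1) * P      ∎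
        where open ≡-Reasoning

module LegendreSymbol (k : ℕ) where

  open import Data.Nat as ℕ using (ℕ; _%_; _<_; _≤_; _≡ᵇ_)
  import Data.Nat.Properties as ℕP
  open import Data.Nat.DivMod using (m%n<n; m<n⇒m%n≡m)
  import Data.Nat.Divisibility as ℕ∣
  open import Data.Nat.Primality using (Prime)
  open import Data.Integer as ℤ using (ℤ; +_; -[1+_]; _+_; _*_; _-_; -_)
  import Data.Integer.Properties as ℤP
  open import Data.Integer.Divisibility.Signed using (∣⇒∣ᵤ)
  open import Data.Integer.Solver using (module +-*-Solver)
  open import Data.Bool using (Bool; true; false; T; if_then_else_)
  open import Data.Bool.ListAction using (any)
  open import Data.List using (upTo)
  open import Data.List.Membership.Propositional using (lose)
  open import Data.List.Membership.Propositional.Properties using (∈-upTo⁺)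
  open import Data.List.Relation.Unary.Any using (satisfied)
  open import Data.List.Relation.Unary.Any.Properties using (any⁺; any⁻)
  open import Data.Sum using (_⊎_; inj₁; inj₂; [_,_]′)
  open import Function using (_∘_)
  open import Data.Product using (∃; _,_)
  open import Data.Unit using (tt)
  open import Data.Empty using (⊥; ⊥-elim)
  open import Relation.Binary.PropositionalEquality
  open import Relation.Nullary using (¬_; Dec; yes; no)
  open import Defs using (legendre)
  open Sums using (module ℤΣ)
  open Ranges

  ≡ᵇ-true⇒≡ : ∀ {m n} → (m ≡ᵇ n) ≡ true → m ≡ n
  ≡ᵇ-true⇒≡ {m} {n} e = ℕP.≡ᵇ⇒≡ m n (subst T (sym e) tt)

  open Congruence k

  χ : ℕ → ℤ
  χ x = legendre p x

  IsSquare : ℕ → Set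
  IsSquare x = ∃ λ z → + (z ℕ.* z) ≋ + x

  square-mod : ∀ z → + ((z % p) ℕ.* (z % p)) ≋ + (z ℕ.* z)
  square-mod z = ≡⇒≋ (ℤP.pos-* (z % p) (z % p)) ⟨≋⟩ ≋-* (mod≋ z) (mod≋ z) ⟨≋⟩ ≡⇒≋ (sym (ℤP.pos-* z z))

  squareTest : ℕ → Bool
  squareTest r = any (λ y → (y ℕ.* y) % p ≡ᵇ r) (upTo p)

  squareTest⇒IsSquare : ∀ x → T (squareTest (x % p)) → IsSquare x
  squareTest⇒IsSquare x t with satisfied (any⁻ _ (upTo p) t)
  ... | y , yy = y , %⇒≋ (ℕP.≡ᵇ⇒≡ _ _ yy)

  IsSquare⇒squareTest : ∀ x → IsSquare x → T (squareTest (x % p))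
  IsSquare⇒squareTest x (z , zz) = any⁺ _ (lose (∈-upTo⁺ (m%n<n z p)) (ℕP.≡⇒≡ᵇ _ _ (≋⇒% (square-mod z ⟨≋⟩ zz))))

  IsSquare? : ∀ x → Dec (IsSquare x)
  IsSquare? x with squareTest (x % p) in e
  ... | true  = yes (squareTest⇒IsSquare x (subst T (sym e) tt))
  ... | false = no (λ sq → subst T e (IsSquare⇒squareTest x sq))

  χ-residue : ℕ → ℤ
  χ-residue r = if r ≡ᵇ 0 then + 0 else (if squareTest r then + 1 else -[1+ 0 ])

  χ≡χ-residue : ∀ x → χ x ≡ χ-residue (x % p)
  χ≡χ-residue x with x % p ≡ᵇ 0
  ... | true  = refl
  ... | false = refl

  χ-cong : ∀ {x y} → + x ≋ + y → χ x ≡ χ y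
  χ-cong {x} {y} h = trans (χ≡χ-residue x) (trans (cong χ-residue (≋⇒% h)) (sym (χ≡χ-residue y)))

  χ-zero : ∀ {x} → + x ≋ + 0 → χ x ≡ + 0
  χ-zero {x} h rewrite χ≡χ-residue x | ≋⇒% h = refl

  χ-square : ∀ {x} → ¬ (+ x ≋ + 0) → IsSquare x → χ x ≡ + 1
  χ-square {x} x≢0 sq rewrite χ≡χ-residue x with x % p ≡ᵇ 0 in e
  ... | true  = ⊥-elim (x≢0 (%⇒≋ (≡ᵇ-true⇒≡ e)))
  ... | false with squareTest (x % p) | IsSquare⇒squareTest x sq
  ... | true | _ = refl

  χ-nonSquare : ∀ {x} → ¬ (+ x ≋ + 0) → ¬ IsSquare x → χ x ≡ -[1+ 0 ]
  χ-nonSquare {x} x≢0 nsq rewrite χ≡χ-residue x with x % p ≡ᵇ 0 in e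
  ... | true  = ⊥-elim (x≢0 (%⇒≋ (≡ᵇ-true⇒≡ e)))
  ... | false with squareTest (x % p) in s
  ... | true  = ⊥-elim (nsq (squareTest⇒IsSquare x (subst T (sym s) tt)))
  ... | false = refl

  ∣χ∣≤1 : ∀ x → ℤ.∣ χ x ∣ ≤ 1
  ∣χ∣≤1 x rewrite χ≡χ-residue x with x % p ≡ᵇ 0
  ... | true  = ℕ.z≤n
  ... | false with squareTest (x % p)
  ... | true  = ℕP.≤-refl
  ... | false = ℕP.≤-refl

  I : ℕ → ℕ → ℤ
  I x y = + δ (x % p) (y % p)

  I-≋ : ∀ {x y} → + x ≋ + y → I x y ≡ + 1
  I-≋ {x} {y} h rewrite ≋⇒% h = cong +_ (δ-refl (y % p))

  I-≋̸ : ∀ {x y} → ¬ (+ x ≋ + y) → I x y ≡ + 0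
  I-≋̸ h = cong +_ (δ-≢ (λ e → h (%⇒≋ e)))

  I-iff : ∀ {a b c d} → (+ a ≋ + b → + c ≋ + d) → (+ c ≋ + d → + a ≋ + b) → I a b ≡ I c d
  I-iff {a} {b} f g with ≋-dec (+ a) (+ b)
  ... | yes h = trans (I-≋ h) (sym (I-≋ (f h)))
  ... | no h  = trans (I-≋̸ h) (sym (I-≋̸ (λ x → h (g x))))

  I-sym : ∀ a b → I a b ≡ I b a
  I-sym a b = I-iff {a} {b} ≋-sym ≋-sym

  Σ<-I : ∀ c → Σ< p (I c) ≡ + 1
  Σ<-I c = trans (Σ<-cong p (λ t t<p → cong (λ z → + δ (c % p) z) (m<n⇒m%n≡m t<p))) (Σ<-δ p (c % p) (m%n<n c p))

  Σ<-I′ : ∀ c → Σ< p (λ t → I t c) ≡ + 1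
  Σ<-I′ c = trans (Σ<-cong p (λ t _ → I-sym t c)) (Σ<-I c)

  module OddPrime (prime : Prime p) (p∤2 : ¬ (p ℕ∣.∣ 2)) where

    open +-*-Solver

    2≋̸0 : ¬ (+ 2 ≋ + 0)
    2≋̸0 h = p∤2 (∣⇒∣ᵤ (≋0⇒∣ h))

    double≋0⇒≋0 : ∀ {a} → a + a ≋ + 0 → a ≋ + 0
    double≋0⇒≋0 {a} h with ≋0-* prime (≡⇒≋ (solve 1 (λ a → con (+ 2) :* a := a :+ a) refl a) ⟨≋⟩ h)
    ... | inj₁ 2≋0 = ⊥-elim (2≋̸0 2≋0)
    ... | inj₂ a≋0 = a≋0

    roots : ℕ → ℤ
    roots w = Σ< p (λ y → I (y ℕ.* y) w)

    sqr : ∀ y → + (y ℕ.* y) ≡ + y * + y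
    sqr y = ℤP.pos-* y y

    roots-zero : ∀ {w} → + w ≋ + 0 → roots w ≡ + 1
    roots-zero {w} w≋0 = trans (Σ<-cong p (λ y _ → I-iff {y ℕ.* y} {w} {y} {0} root⇒0 0⇒root)) (Σ<-I′ 0)
      where
      root⇒0 : ∀ {y} → + (y ℕ.* y) ≋ + w → + y ≋ + 0
      root⇒0 {y} h with ≋0-* prime (≡⇒≋ (sym (sqr y)) ⟨≋⟩ h ⟨≋⟩ w≋0)
      ... | inj₁ y≋0 = y≋0
      ... | inj₂ y≋0 = y≋0
      0⇒root : ∀ {y} → + y ≋ + 0 → + (y ℕ.* y) ≋ + w
      0⇒root {y} h = ≡⇒≋ (sqr y) ⟨≋⟩ ≋-* h h ⟨≋⟩ ≋-sym w≋0

    -- a nonzero square z² has exactly the two roots z and p - z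
    roots-square : ∀ {w z} → z < p → ¬ (+ z ≋ + 0) → + (z ℕ.* z) ≋ + w → roots w ≡ + 2
    roots-square {w} {z} z<p z≢0 zz = begin
      roots w                                   ≡⟨ Σ<-cong p (λ y _ → root-indicator y) ⟩
      Σ< p (λ y → I y z + I y z′)               ≡⟨ ℤΣ.sum-+ (λ y → I y z) (λ y → I y z′) (upTo p) ⟩
      Σ< p (λ y → I y z) + Σ< p (λ y → I y z′)  ≡⟨ cong₂ _+_ (Σ<-I′ z) (Σ<-I′ z′) ⟩
      + 2                                       ∎
      where
      open ≡-Reasoning
      z′ = p ℕ.∸ z
      z′≋-z : + z′ ≋ - + z
      z′≋-z = ≡⇒≋ (sym (trans (ℤP.m-n≡m⊖n p z) (ℤP.⊖-≥ (ℕP.<⇒≤ z<p)))) ⟨≋⟩ ≋-+ P≋0 (≋-refl { - + z})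
               ⟨≋⟩ ≡⇒≋ (ℤP.+-identityˡ (- + z))
      not-both : ∀ {y} → + y ≋ + z → + y ≋ + z′ → ⊥
      not-both h g = z≢0 (double≋0⇒≋0 (≋-+ (≋-refl {+ z}) (≋-sym h ⟨≋⟩ g ⟨≋⟩ z′≋-z) ⟨≋⟩ ≡⇒≋ (ℤP.+-inverseʳ (+ z))))
      root-z : ∀ {y} → + y ≋ + z → + (y ℕ.* y) ≋ + w
      root-z {y} h = ≡⇒≋ (sqr y) ⟨≋⟩ ≋-* h h ⟨≋⟩ ≡⇒≋ (sym (sqr z)) ⟨≋⟩ zz
      root-z′ : ∀ {y} → + y ≋ + z′ → + (y ℕ.* y) ≋ + w
      root-z′ {y} h = ≡⇒≋ (sqr y) ⟨≋⟩ ≋-* (h ⟨≋⟩ z′≋-z) (h ⟨≋⟩ z′≋-z)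
                      ⟨≋⟩ ≡⇒≋ (solve 1 (λ z → (:- z) :* (:- z) := z :* z) refl (+ z)) ⟨≋⟩ ≡⇒≋ (sym (sqr z)) ⟨≋⟩ zz
      only-roots : ∀ {y} → + (y ℕ.* y) ≋ + w → + y ≋ + z ⊎ + y ≋ + z′
      only-roots {y} h = from-factors (≋0-* prime {+ y - + z} {+ y + + z}
        (≡⇒≋ (solve 2 (λ y z → (y :- z) :* (y :+ z) := y :* y :- z :* z) refl (+ y) (+ z))
         ⟨≋⟩ ≋⇒-≋0 (≡⇒≋ (sym (sqr y)) ⟨≋⟩ h ⟨≋⟩ ≋-sym zz ⟨≋⟩ ≡⇒≋ (sqr z))))
        where
        from-factors : + y - + z ≋ + 0 ⊎ + y + + z ≋ + 0 → + y ≋ + z ⊎ + y ≋ + z′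
        from-factors (inj₁ y-z≋0) = inj₁ (-≋0⇒≋ y-z≋0)
        from-factors (inj₂ y+z≋0) = inj₂ (≡⇒≋ (solve 2 (λ y z → y := (y :+ z) :- z) refl (+ y) (+ z))
          ⟨≋⟩ ≋-+ y+z≋0 (≋-refl { - + z}) ⟨≋⟩ ≡⇒≋ (ℤP.+-identityˡ (- + z)) ⟨≋⟩ ≋-sym z′≋-z)
      root-indicator : ∀ y → I (y ℕ.* y) w ≡ I y z + I y z′
      root-indicator y = by-cases (≋-dec (+ y) (+ z)) (≋-dec (+ y) (+ z′))
        where
        by-cases : Dec (+ y ≋ + z) → Dec (+ y ≋ + z′) → I (y ℕ.* y) w ≡ I y z + I y z′
        by-cases (yes a) (yes b) = ⊥-elim (not-both a b)
        by-cases (yes a) (no b)  = trans (I-≋ (root-z a)) (sym (cong₂ _+_ (I-≋ a) (I-≋̸ b)))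
        by-cases (no a)  (yes b) = trans (I-≋ (root-z′ b)) (sym (cong₂ _+_ (I-≋̸ a) (I-≋ b)))
        by-cases (no a)  (no b)  = trans (I-≋̸ ([ a , b ]′ ∘ only-roots)) (sym (cong₂ _+_ (I-≋̸ a) (I-≋̸ b)))

    roots≡1+χ : ∀ w → roots w ≡ + 1 + χ w
    roots≡1+χ w with ≋-dec (+ w) (+ 0)
    ... | yes w≋0 = trans (roots-zero w≋0) (sym (cong (λ t → + 1 + t) (χ-zero w≋0)))
    ... | no w≢0 with IsSquare? w
    ...   | no nsq = trans (Σ<-zero p _ (λ y _ → I-≋̸ (λ h → nsq (y , h)))) (sym (cong (λ t → + 1 + t) (χ-nonSquare w≢0 nsq)))
    ...   | yes (z , zz) = trans (roots-square (m%n<n z p) (λ h → w≢0 (≋-sym zz′ ⟨≋⟩ ≡⇒≋ (sqr (z % p)) ⟨≋⟩ ≋-* h h)) zz′)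
                                 (sym (cong (λ t → + 1 + t) (χ-square w≢0 (z , zz))))
      where
      zz′ : + ((z % p) ℕ.* (z % p)) ≋ + w
      zz′ = square-mod z ⟨≋⟩ zz

module Jacobsthal (k : ℕ) (prime : Prime (suc k)) (p∤2 : ¬ (suc k ℕ∣.∣ 2)) where

  open import Data.Nat as ℕ using (ℕ; suc; _%_; _<_; _≤_)
  import Data.Nat.Properties as ℕP
  open import Data.Nat.DivMod using (m%n<n; m<n⇒m%n≡m; m%n≤n)
  open import Data.Integer using (ℤ; +_; -[1+_]; _+_; _*_; _-_; -_)
  import Data.Integer.Properties as ℤP
  open import Data.Integer.Solver using (module +-*-Solver)
  open import Data.List using (upTo)
  open import Data.Sum using ([_,_]′)
  open import Data.Product using (∃; _,_)
  open import Data.Empty using (⊥-elim)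
  open import Relation.Binary.PropositionalEquality
  open import Relation.Nullary using (¬_; Dec; yes; no)
  open import Function using (_∘_)
  open Sums using (module ℤΣ)
  open Ranges

  open Congruence k
  open LegendreSymbol k
  open OddPrime prime p∤2
  open +-*-Solver

  χ≡roots-1 : ∀ x → χ x ≡ roots x - + 1
  χ≡roots-1 x rewrite roots≡1+χ x = solve 1 (λ c → c := (con (+ 1) :+ c) :- con (+ 1)) refl (χ x)

  Σ<-I-shift : ∀ a c → Σ< p (λ t → I a (t ℕ.+ c)) ≡ + 1
  Σ<-I-shift a c = trans (Σ<-cong p (λ t _ → I-iff {a} {t ℕ.+ c} {a ℕ.+ d} {t} (fwd t) (bwd t))) (Σ<-I (a ℕ.+ d))
    where
    d = p ℕ.∸ (c % p)
    c+d≋0 : + c + + d ≋ + 0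
    c+d≋0 = ≋-+ (≋-sym (mod≋ c)) (≋-refl {+ d})
            ⟨≋⟩ ≡⇒≋ (trans (sym (ℤP.pos-+ (c % p) d)) (cong +_ (ℕP.m+[n∸m]≡n (m%n≤n c p)))) ⟨≋⟩ P≋0
    fwd : ∀ t → + a ≋ + (t ℕ.+ c) → + (a ℕ.+ d) ≋ + t
    fwd t h = ≡⇒≋ (ℤP.pos-+ a d) ⟨≋⟩ ≋-+ (h ⟨≋⟩ ≡⇒≋ (ℤP.pos-+ t c)) (≋-refl {+ d}) ⟨≋⟩ ≡⇒≋ (ℤP.+-assoc (+ t) (+ c) (+ d))
              ⟨≋⟩ ≋-+ (≋-refl {+ t}) c+d≋0 ⟨≋⟩ ≡⇒≋ (ℤP.+-identityʳ (+ t))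
    bwd : ∀ t → + (a ℕ.+ d) ≋ + t → + a ≋ + (t ℕ.+ c)
    bwd t h = ≡⇒≋ (solve 3 (λ a c d → a := ((a :+ d) :+ c) :- (c :+ d)) refl (+ a) (+ c) (+ d))
              ⟨≋⟩ ≋-+ (≋-+ (≡⇒≋ (sym (ℤP.pos-+ a d)) ⟨≋⟩ h) (≋-refl {+ c})) (≋-neg c+d≋0)
              ⟨≋⟩ ≡⇒≋ (trans (ℤP.+-identityʳ (+ t + + c)) (sym (ℤP.pos-+ t c)))

  Σ<-roots-shift : ∀ c → Σ< p (λ t → roots (t ℕ.+ c)) ≡ + p
  Σ<-roots-shift c = trans (ℤΣ.sum-swap (λ t y → I (y ℕ.* y) (t ℕ.+ c)) (upTo p) (upTo p))
                      (trans (Σ<-cong p (λ y _ → Σ<-I-shift (y ℕ.* y) c)) (Σ<-one p))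

  Σ<-roots : Σ< p roots ≡ + p
  Σ<-roots = trans (Σ<-cong p (λ t _ → cong roots (sym (ℕP.+-identityʳ t)))) (Σ<-roots-shift 0)

  conicCount : ℕ → ℤ
  conicCount c = Σ< p (λ y → Σ< p (λ z → I (z ℕ.* z) (y ℕ.* y ℕ.+ c)))

  Σ<-I-I-shift : ∀ a b c → Σ< p (λ t → I a t * I b (t ℕ.+ c)) ≡ I b (a ℕ.+ c)
  Σ<-I-I-shift a b c = begin
    Σ< p (λ t → I a t * I b (t ℕ.+ c))   ≡⟨ Σ<-cong p (λ t _ → on-diagonal t (≋-dec (+ a) (+ t))) ⟩
    Σ< p (λ t → I a t * I b (a ℕ.+ c))   ≡⟨ ℤΣ.sum-*ʳ (I b (a ℕ.+ c)) (I a) (upTo p) ⟨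
    Σ< p (I a) * I b (a ℕ.+ c)           ≡⟨ cong (_* I b (a ℕ.+ c)) (Σ<-I a) ⟩
    + 1 * I b (a ℕ.+ c)                  ≡⟨ ℤP.*-identityˡ _ ⟩
    I b (a ℕ.+ c)                        ∎
    where
    open ≡-Reasoning
    on-diagonal : ∀ t → Dec (+ a ≋ + t) → I a t * I b (t ℕ.+ c) ≡ I a t * I b (a ℕ.+ c)
    on-diagonal t (no a≢t) = trans (cong (_* I b (t ℕ.+ c)) (I-≋̸ a≢t)) (sym (cong (_* I b (a ℕ.+ c)) (I-≋̸ a≢t)))
    on-diagonal t (yes a≋t) = cong (I a t *_) (I-iff {b} {t ℕ.+ c} {b} {a ℕ.+ c}
      (λ g → g ⟨≋⟩ ≡⇒≋ (ℤP.pos-+ t c) ⟨≋⟩ ≋-+ (≋-sym a≋t) (≋-refl {+ c}) ⟨≋⟩ ≡⇒≋ (sym (ℤP.pos-+ a c)))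
      (λ g → g ⟨≋⟩ ≡⇒≋ (ℤP.pos-+ a c) ⟨≋⟩ ≋-+ a≋t (≋-refl {+ c}) ⟨≋⟩ ≡⇒≋ (sym (ℤP.pos-+ t c))))

  Σ<-roots*roots-shift : ∀ c → Σ< p (λ t → roots t * roots (t ℕ.+ c)) ≡ conicCount c
  Σ<-roots*roots-shift c = begin
    Σ< p (λ t → roots t * roots (t ℕ.+ c))
      ≡⟨ Σ<-cong p (λ t _ → ℤΣ.sum-mul (λ y → I (y ℕ.* y) t) (λ z → I (z ℕ.* z) (t ℕ.+ c)) (upTo p) (upTo p)) ⟩
    Σ< p (λ t → Σ< p (λ y → Σ< p (λ z → I (y ℕ.* y) t * I (z ℕ.* z) (t ℕ.+ c))))
      ≡⟨ ℤΣ.sum-swap (λ t y → Σ< p (λ z → I (y ℕ.* y) t * I (z ℕ.* z) (t ℕ.+ c))) (upTo p) (upTo p) ⟩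
    Σ< p (λ y → Σ< p (λ t → Σ< p (λ z → I (y ℕ.* y) t * I (z ℕ.* z) (t ℕ.+ c))))
      ≡⟨ Σ<-cong p (λ y _ → trans (ℤΣ.sum-swap (λ t z → I (y ℕ.* y) t * I (z ℕ.* z) (t ℕ.+ c)) (upTo p) (upTo p))
           (Σ<-cong p (λ z _ → Σ<-I-I-shift (y ℕ.* y) (z ℕ.* z) c))) ⟩
    conicCount c ∎
    where open ≡-Reasoning

  module _ (c : ℕ) (c≢0 : ¬ (+ c ≋ + 0)) where

    onConic : ℕ → ℕ → ℤ
    onConic y u = I ((y ℕ.+ u) ℕ.* (y ℕ.+ u)) (y ℕ.* y ℕ.+ c)

    conic-row-shift : ∀ y → y < p → Σ< p (λ z → I (z ℕ.* z) (y ℕ.* y ℕ.+ c)) ≡ Σ< p (onConic y)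
    conic-row-shift y y<p = sym (trans (Σ<-cong p (λ u _ → sym (fσ u)))
                              (Σ<-reindex p σ τ f (λ u _ → m%n<n (y ℕ.+ u) p) (λ z _ → m%n<n (z ℕ.+ (p ℕ.∸ y)) p) τσ στ))
      where
      f : ℕ → ℤ
      f z = I (z ℕ.* z) (y ℕ.* y ℕ.+ c)
      σ τ : ℕ → ℕ
      σ u = (y ℕ.+ u) % p
      τ z = (z ℕ.+ (p ℕ.∸ y)) % p
      p-y : + (p ℕ.∸ y) ≡ P - + y
      p-y = sym (trans (ℤP.m-n≡m⊖n p y) (ℤP.⊖-≥ (ℕP.<⇒≤ y<p)))
      fσ : ∀ u → f (σ u) ≡ onConic y u
      fσ u = I-iff {σ u ℕ.* σ u} {y ℕ.* y ℕ.+ c} {(y ℕ.+ u) ℕ.* (y ℕ.+ u)} {y ℕ.* y ℕ.+ c} (λ h → ≋-sym (square-mod (y ℕ.+ u)) ⟨≋⟩ h) (λ h → square-mod (y ℕ.+ u) ⟨≋⟩ h)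
      τσ : ∀ u → u < p → τ (σ u) ≡ u
      τσ u u<p = residue≡ u<p (≡⇒≋ (ℤP.pos-+ (σ u) (p ℕ.∸ y)) ⟨≋⟩ ≋-+ (mod≋ (y ℕ.+ u) ⟨≋⟩ ≡⇒≋ (ℤP.pos-+ y u)) (≡⇒≋ p-y)
                   ⟨≋⟩ ≡⇒≋ (solve 3 (λ y u p → (y :+ u) :+ (p :- y) := u :+ con (+ 1) :* p) refl (+ y) (+ u) P) ⟨≋⟩ ≋-+-multiple (+ u) (+ 1))
      στ : ∀ z → z < p → σ (τ z) ≡ z
      στ z z<p = residue≡ z<p (≡⇒≋ (ℤP.pos-+ y (τ z))
                   ⟨≋⟩ ≋-+ (≋-refl {+ y}) (mod≋ (z ℕ.+ (p ℕ.∸ y)) ⟨≋⟩ ≡⇒≋ (trans (ℤP.pos-+ z (p ℕ.∸ y)) (cong (λ t → + z + t) p-y)))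
                   ⟨≋⟩ ≡⇒≋ (solve 3 (λ y z p → y :+ (z :+ (p :- y)) := z :+ con (+ 1) :* p) refl (+ y) (+ z) P) ⟨≋⟩ ≋-+-multiple (+ z) (+ 1))

    square-expand : ∀ y u → + ((y ℕ.+ u) ℕ.* (y ℕ.+ u)) ≡ + (y ℕ.* y) + ((+ 2 * + u) * + y + + u * + u)
    square-expand y u = trans (ℤP.pos-* (y ℕ.+ u) (y ℕ.+ u)) (trans (cong₂ _*_ (ℤP.pos-+ y u) (ℤP.pos-+ y u))
      (trans (solve 2 (λ y u → (y :+ u) :* (y :+ u) := y :* y :+ ((con (+ 2) :* u) :* y :+ u :* u)) refl (+ y) (+ u))
        (cong (_+ ((+ 2 * + u) * + y + + u * + u)) (sym (ℤP.pos-* y y)))))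

    onConic⇒ : ∀ y u → + ((y ℕ.+ u) ℕ.* (y ℕ.+ u)) ≋ + (y ℕ.* y ℕ.+ c) → (+ 2 * + u) * + y + + u * + u ≋ + c
    onConic⇒ y u h = ≋-cancelˡ-+ {+ (y ℕ.* y)} (≡⇒≋ (sym (square-expand y u)) ⟨≋⟩ h ⟨≋⟩ ≡⇒≋ (ℤP.pos-+ (y ℕ.* y) c))

    onConic⇐ : ∀ y u → (+ 2 * + u) * + y + + u * + u ≋ + c → + ((y ℕ.+ u) ℕ.* (y ℕ.+ u)) ≋ + (y ℕ.* y ℕ.+ c)
    onConic⇐ y u h = ≡⇒≋ (square-expand y u) ⟨≋⟩ ≋-+ (≋-refl {+ (y ℕ.* y)}) h ⟨≋⟩ ≡⇒≋ (sym (ℤP.pos-+ (y ℕ.* y) c))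

    conic-column-zero : ∀ u → + u ≋ + 0 → Σ< p (λ y → onConic y u) ≡ + 0
    conic-column-zero u u≋0 = Σ<-zero p (λ y → onConic y u) (λ y _ → I-≋̸ (λ h → c≢0 (≋-sym (onConic⇒ y u h) ⟨≋⟩ lhs≋0)))
      where
      lhs≋0 : ∀ {y} → (+ 2 * + u) * + y + + u * + u ≋ + 0
      lhs≋0 {y} = ≋-+ (≋-* (≋-* (≋-refl {+ 2}) u≋0) (≋-refl {+ y})) (≋-* u≋0 u≋0)
                  ⟨≋⟩ ≡⇒≋ (solve 1 (λ y → (con (+ 2) :* con (+ 0)) :* y :+ con (+ 0) :* con (+ 0) := con (+ 0)) refl (+ y))

    -- for u ≢ 0 the equation 2 u y + u² = c is linear in y with the unique root (c - u²) (2u)⁻¹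
    conic-column-unit : ∀ u → ¬ (+ u ≋ + 0) → Σ< p (λ y → onConic y u) ≡ + 1
    conic-column-unit u u≢0 = unique-root (inverse prime (2 ℕ.* u) (λ h → 2u≢0 (≡⇒≋ (sym (ℤP.pos-* 2 u)) ⟨≋⟩ h)))
      where
      2u = + 2 * + u
      2u≢0 : ¬ (2u ≋ + 0)
      2u≢0 h = [ 2≋̸0 , u≢0 ]′ (≋0-* prime h)
      unique-root : (∃ λ v → + (2 ℕ.* u) * + v ≋ + 1) → Σ< p (λ y → onConic y u) ≡ + 1
      unique-root (v , v-inv) = trans (Σ<-cong p (λ y _ → I-iff {(y ℕ.+ u) ℕ.* (y ℕ.+ u)} {y ℕ.* y ℕ.+ c} {y} {y₀} (root⇒ y) (⇒root y))) (Σ<-I′ y₀)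
        where
        2u*v≋1 : 2u * + v ≋ + 1
        2u*v≋1 = ≋-* (≡⇒≋ (sym (ℤP.pos-* 2 u))) (≋-refl {+ v}) ⟨≋⟩ v-inv
        y₀ = rep ((+ c - + u * + u) * + v)
        y₀-root : 2u * + y₀ + + u * + u ≋ + c
        y₀-root = ≋-+ (≋-* (≋-refl {2u}) (rep≋ _)) (≋-refl {+ u * + u})
             ⟨≋⟩ ≡⇒≋ (solve 4 (λ a c w v → a :* ((c :- w) :* v) :+ w := (c :- w) :* (a :* v) :+ w) refl 2u (+ c) (+ u * + u) (+ v))
             ⟨≋⟩ ≋-+ (≋-* (≋-refl {+ c - + u * + u}) 2u*v≋1) (≋-refl {+ u * + u})
             ⟨≋⟩ ≡⇒≋ (solve 2 (λ c w → (c :- w) :* con (+ 1) :+ w := c) refl (+ c) (+ u * + u))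
        root⇒ : ∀ y → + ((y ℕ.+ u) ℕ.* (y ℕ.+ u)) ≋ + (y ℕ.* y ℕ.+ c) → + y ≋ + y₀
        root⇒ y h = -≋0⇒≋ ([ (λ 2u≋0 → ⊥-elim (2u≢0 2u≋0)) , (λ d → d) ]′ (≋0-* prime {2u} {+ y - + y₀}
          (≡⇒≋ (solve 4 (λ a y z w → a :* (y :- z) := (a :* y :+ w) :- (a :* z :+ w)) refl 2u (+ y) (+ y₀) (+ u * + u))
           ⟨≋⟩ ≋⇒-≋0 (onConic⇒ y u h ⟨≋⟩ ≋-sym y₀-root))))
        ⇒root : ∀ y → + y ≋ + y₀ → + ((y ℕ.+ u) ℕ.* (y ℕ.+ u)) ≋ + (y ℕ.* y ℕ.+ c)
        ⇒root y h = onConic⇐ y u (≋-+ (≋-* (≋-refl {2u}) h) (≋-refl {+ u * + u}) ⟨≋⟩ y₀-root)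

    conicCount+1≡p : conicCount c + + 1 ≡ + p
    conicCount+1≡p = begin
      conicCount c + + 1
        ≡⟨ cong₂ _+_ (Σ<-cong p (λ y y<p → conic-row-shift y y<p)) (sym (Σ<-I′ 0)) ⟩
      Σ< p (λ y → Σ< p (onConic y)) + Σ< p (λ u → I u 0)
        ≡⟨ cong (_+ Σ< p (λ u → I u 0)) (ℤΣ.sum-swap onConic (upTo p) (upTo p)) ⟩
      Σ< p (λ u → Σ< p (λ y → onConic y u)) + Σ< p (λ u → I u 0)
        ≡⟨ ℤΣ.sum-+ (λ u → Σ< p (λ y → onConic y u)) (λ u → I u 0) (upTo p) ⟨
      Σ< p (λ u → Σ< p (λ y → onConic y u) + I u 0)
        ≡⟨ Σ<-cong p (λ u _ → column (≋-dec (+ u) (+ 0))) ⟩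
      Σ< p (λ _ → + 1)
        ≡⟨ Σ<-one p ⟩
      + p ∎
      where
      open ≡-Reasoning
      column : ∀ {u} → Dec (+ u ≋ + 0) → Σ< p (λ y → onConic y u) + I u 0 ≡ + 1
      column {u} (yes u≋0) = cong₂ _+_ (conic-column-zero u u≋0) (I-≋ u≋0)
      column {u} (no u≢0)  = cong₂ _+_ (conic-column-unit u u≢0) (I-≋̸ u≢0)

    -- with χ = roots − 1 the sum becomes Σ roots·roots′ − Σ roots − Σ roots′ + p = (p − 1) − p − p + p
    jacobsthal : Σ< p (λ t → χ t * χ (t ℕ.+ c)) ≡ -[1+ 0 ]
    jacobsthal = begin
      K                                     ≡⟨ solve 2 (λ K P → K := (K :+ (P :+ P)) :- (P :+ P)) refl K P ⟩
      (K + (P + P)) - (P + P)               ≡⟨ cong (λ t → t - (P + P)) K+2p≡D+p ⟩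
      (D + P) - (P + P)                     ≡⟨ cong (λ t → (D + t) - (t + t)) (sym conicCount+1≡p) ⟩
      (D + (D + + 1)) - ((D + + 1) + (D + + 1))
        ≡⟨ solve 1 (λ D → (D :+ (D :+ con (+ 1))) :- ((D :+ con (+ 1)) :+ (D :+ con (+ 1))) := con -[1+ 0 ]) refl D ⟩
      -[1+ 0 ]                              ∎
      where
      open ≡-Reasoning
      K = Σ< p (λ t → χ t * χ (t ℕ.+ c))
      D = conicCount c
      pointwise : ∀ t → χ t * χ (t ℕ.+ c) + (roots t + roots (t ℕ.+ c)) ≡ roots t * roots (t ℕ.+ c) + + 1
      pointwise t = trans (cong₂ (λ a b → a * b + (roots t + roots (t ℕ.+ c))) (χ≡roots-1 t) (χ≡roots-1 (t ℕ.+ c)))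
        (solve 2 (λ a b → (a :- con (+ 1)) :* (b :- con (+ 1)) :+ (a :+ b) := a :* b :+ con (+ 1)) refl (roots t) (roots (t ℕ.+ c)))
      K+2p≡D+p : K + (P + P) ≡ D + P
      K+2p≡D+p = begin
        K + (P + P)
          ≡⟨ cong (λ t → K + t) (sym (cong₂ _+_ Σ<-roots (Σ<-roots-shift c))) ⟩
        K + (Σ< p roots + Σ< p (λ t → roots (t ℕ.+ c)))
          ≡⟨ cong (λ t → K + t) (ℤΣ.sum-+ roots (λ t → roots (t ℕ.+ c)) (upTo p)) ⟨
        K + Σ< p (λ t → roots t + roots (t ℕ.+ c))
          ≡⟨ ℤΣ.sum-+ (λ t → χ t * χ (t ℕ.+ c)) (λ t → roots t + roots (t ℕ.+ c)) (upTo p) ⟨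
        Σ< p (λ t → χ t * χ (t ℕ.+ c) + (roots t + roots (t ℕ.+ c)))
          ≡⟨ ℤΣ.sum-cong (upTo p) pointwise ⟩
        Σ< p (λ t → roots t * roots (t ℕ.+ c) + + 1)
          ≡⟨ ℤΣ.sum-+ (λ t → roots t * roots (t ℕ.+ c)) (λ _ → + 1) (upTo p) ⟩
        Σ< p (λ t → roots t * roots (t ℕ.+ c)) + Σ< p (λ _ → + 1)
          ≡⟨ cong₂ _+_ (Σ<-roots*roots-shift c) (Σ<-one p) ⟩
        D + P ∎

  Σ<-χ*χ-permuted : ∀ c → ¬ (+ c ≋ + 0) → (σ τ g h : ℕ → ℕ) →
    (∀ t → t < p → σ t < p) → (∀ t → t < p → τ t < p) →
    (∀ t → t < p → τ (σ t) ≡ t) → (∀ t → t < p → σ (τ t) ≡ t) →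
    (∀ t → t < p → + g t ≋ + σ t) → (∀ t → t < p → + h t ≋ + (σ t ℕ.+ c)) →
    Σ< p (λ t → χ (g t) * χ (h t)) ≡ -[1+ 0 ]
  Σ<-χ*χ-permuted c c≢0 σ τ g h σ< τ< τσ στ g≋ h≋ =
    trans (Σ<-cong p (λ t t<p → cong₂ _*_ (χ-cong (g≋ t t<p)) (χ-cong (h≋ t t<p))))
          (trans (Σ<-reindex p σ τ (λ t → χ t * χ (t ℕ.+ c)) σ< τ< τσ στ) (jacobsthal c c≢0))

  ∸-as-sub : ∀ x i → i < p → + (x ℕ.+ p ℕ.∸ i) ≡ + x + P - + i
  ∸-as-sub x i i<p = trans (sym (trans (ℤP.m-n≡m⊖n (x ℕ.+ p) i) (ℤP.⊖-≥ (ℕP.≤-trans (ℕP.<⇒≤ i<p) (ℕP.m≤n+m p x)))))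
                           (cong (_- + i) (ℤP.pos-+ x p))

  shift≢0 : ∀ {x y} → x < p → y < p → x ≢ y → ¬ (+ (y ℕ.+ p ℕ.∸ x) ≋ + 0)
  shift≢0 {x} {y} x<p y<p x≢y h = x≢y (sym (trans (sym (m<n⇒m%n≡m y<p)) (residue≡ x<p y≋x)))
    where
    y≋x : + y ≋ + x
    y≋x = -≋0⇒≋ (≡⇒≋ (solve 3 (λ y x p → y :- x := (y :+ p :- x) :- con (+ 1) :* p) refl (+ y) (+ x) P)
            ⟨≋⟩ ≋-+ (≡⇒≋ (sym (∸-as-sub y x x<p)) ⟨≋⟩ h) (≋-neg (≡⇒≋ (ℤP.*-identityˡ P) ⟨≋⟩ P≋0)))

  χ-correlation-rows : ∀ x y → x < p → y < p → x ≢ y →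
    Σ< p (λ i → χ (x ℕ.+ p ℕ.∸ i) * χ (y ℕ.+ p ℕ.∸ i)) ≡ -[1+ 0 ]
  χ-correlation-rows x y x<p y<p x≢y =
    Σ<-χ*χ-permuted c (shift≢0 x<p y<p x≢y) σ σ (λ i → x ℕ.+ p ℕ.∸ i) (λ i → y ℕ.+ p ℕ.∸ i)
      σ< σ< σσ σσ (λ i _ → ≋-sym (mod≋ (x ℕ.+ p ℕ.∸ i))) h≋
    where
    c = y ℕ.+ p ℕ.∸ x
    σ : ℕ → ℕ
    σ i = (x ℕ.+ p ℕ.∸ i) % p
    σ< : ∀ i → i < p → σ i < p
    σ< i _ = m%n<n (x ℕ.+ p ℕ.∸ i) p
    σσ : ∀ i → i < p → σ (σ i) ≡ i
    σσ i i<p = residue≡ i<p (≡⇒≋ (∸-as-sub x (σ i) (σ< i i<p))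
      ⟨≋⟩ ≋-+ (≋-refl {+ x + P}) (≋-neg (mod≋ (x ℕ.+ p ℕ.∸ i) ⟨≋⟩ ≡⇒≋ (∸-as-sub x i i<p)))
      ⟨≋⟩ ≡⇒≋ (solve 3 (λ x i p → (x :+ p) :+ (:- (x :+ p :- i)) := i) refl (+ x) (+ i) P))
    h≋ : ∀ i → i < p → + (y ℕ.+ p ℕ.∸ i) ≋ + (σ i ℕ.+ c)
    h≋ i i<p = ≡⇒≋ (∸-as-sub y i i<p) ⟨≋⟩ ≋-sym (≡⇒≋ (ℤP.pos-+ (σ i) c)
      ⟨≋⟩ ≋-+ (mod≋ (x ℕ.+ p ℕ.∸ i) ⟨≋⟩ ≡⇒≋ (∸-as-sub x i i<p)) (≡⇒≋ (∸-as-sub y x x<p))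
      ⟨≋⟩ ≡⇒≋ (solve 4 (λ x y i p → (x :+ p :- i) :+ (y :+ p :- x) := (y :+ p :- i) :+ con (+ 1) :* p) refl (+ x) (+ y) (+ i) P)
      ⟨≋⟩ ≋-+-multiple (+ y + P - + i) (+ 1))

  χ-correlation-columns : ∀ i j → i < p → j < p → i ≢ j →
    Σ< p (λ a → χ (a ℕ.+ p ℕ.∸ i) * χ (a ℕ.+ p ℕ.∸ j)) ≡ -[1+ 0 ]
  χ-correlation-columns i j i<p j<p i≢j =
    Σ<-χ*χ-permuted c (shift≢0 j<p i<p (i≢j ∘ sym)) σ τ (λ a → a ℕ.+ p ℕ.∸ i) (λ a → a ℕ.+ p ℕ.∸ j)
      (λ a _ → m%n<n (a ℕ.+ p ℕ.∸ i) p) (λ t _ → m%n<n (t ℕ.+ i) p) τσ στ (λ a _ → ≋-sym (mod≋ (a ℕ.+ p ℕ.∸ i))) h≋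
    where
    c = i ℕ.+ p ℕ.∸ j
    σ τ : ℕ → ℕ
    σ a = (a ℕ.+ p ℕ.∸ i) % p
    τ t = (t ℕ.+ i) % p
    τσ : ∀ a → a < p → τ (σ a) ≡ a
    τσ a a<p = residue≡ a<p (≡⇒≋ (ℤP.pos-+ (σ a) i) ⟨≋⟩ ≋-+ (mod≋ (a ℕ.+ p ℕ.∸ i) ⟨≋⟩ ≡⇒≋ (∸-as-sub a i i<p)) (≋-refl {+ i})
      ⟨≋⟩ ≡⇒≋ (solve 3 (λ a i p → (a :+ p :- i) :+ i := a :+ con (+ 1) :* p) refl (+ a) (+ i) P) ⟨≋⟩ ≋-+-multiple (+ a) (+ 1))
    στ : ∀ t → t < p → σ (τ t) ≡ t
    στ t t<p = residue≡ t<p (≡⇒≋ (∸-as-sub (τ t) i i<p)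
      ⟨≋⟩ ≋-+ (≋-+ (mod≋ (t ℕ.+ i) ⟨≋⟩ ≡⇒≋ (ℤP.pos-+ t i)) (≋-refl {P})) (≋-refl { - + i})
      ⟨≋⟩ ≡⇒≋ (solve 3 (λ t i p → ((t :+ i) :+ p) :- i := t :+ con (+ 1) :* p) refl (+ t) (+ i) P) ⟨≋⟩ ≋-+-multiple (+ t) (+ 1))
    h≋ : ∀ a → a < p → + (a ℕ.+ p ℕ.∸ j) ≋ + (σ a ℕ.+ c)
    h≋ a a<p = ≡⇒≋ (∸-as-sub a j j<p) ⟨≋⟩ ≋-sym (≡⇒≋ (ℤP.pos-+ (σ a) c)
      ⟨≋⟩ ≋-+ (mod≋ (a ℕ.+ p ℕ.∸ i) ⟨≋⟩ ≡⇒≋ (∸-as-sub a i i<p)) (≡⇒≋ (∸-as-sub i j j<p))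
      ⟨≋⟩ ≡⇒≋ (solve 4 (λ a i j p → (a :+ p :- i) :+ (i :+ p :- j) := (a :+ p :- j) :+ con (+ 1) :* p) refl (+ a) (+ i) (+ j) P)
      ⟨≋⟩ ≋-+-multiple (+ a + P - + j) (+ 1))

open import Data.Nat as ℕ using (zero; _<_; _≤_; _≡ᵇ_)
import Data.Nat.Properties as ℕP
open import Data.Nat.Primality using (¬prime[0]; ¬prime[1])
open import Data.Integer as ℤ using (ℤ; +_)
import Data.Integer.Properties as ℤP
open import Data.Integer.Solver using (module +-*-Solver)
open import Data.Nat.Solver using () renaming (module +-*-Solver to ℕ-Solver)
open import Data.Bool using (true; false; if_then_else_; not; _∨_)
open import Data.Bool.Properties using (∨-assoc; ∨-comm)
open import Data.List using (upTo)
open import Data.List.Membership.Propositional.Properties using (∈-upTo⁻)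
open import Data.List.Relation.Unary.All as All using (All)
open import Data.Product using (_,_; proj₁; proj₂)
open import Relation.Binary.PropositionalEquality
open import Relation.Nullary using (yes; no)
open import Data.Empty using (⊥-elim)
open import Data.Rational as ℚ using ()
open Sums
open RationalFacts
open OperatorNorm
open Ranges

≡ᵇ-sym : ∀ a b → (a ≡ᵇ b) ≡ (b ≡ᵇ a)
≡ᵇ-sym zero    zero    = refl
≡ᵇ-sym zero    (suc b) = refl
≡ᵇ-sym (suc a) zero    = refl
≡ᵇ-sym (suc a) (suc b) = ≡ᵇ-sym a b

∨-swap-middle : ∀ x y z w → (x ∨ y ∨ z ∨ w) ≡ (x ∨ z ∨ y ∨ w)
∨-swap-middle true  y     z     w = refl
∨-swap-middle false true  true  w = refl
∨-swap-middle false true  false w = refl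
∨-swap-middle false false z     w = refl

∨-swap-halves : ∀ x y z w → (x ∨ y ∨ z ∨ w) ≡ (z ∨ w ∨ x ∨ y)
∨-swap-halves x y z w = trans (sym (∨-assoc x y (z ∨ w))) (trans (∨-comm (x ∨ y) (z ∨ w)) (∨-assoc z w (x ∨ y)))

disjoint-sym : ∀ a b c d → disjoint (a , b) (c , d) ≡ disjoint (c , d) (a , b)
disjoint-sym a b c d = cong not (trans (∨-swap-middle (a ≡ᵇ c) (a ≡ᵇ d) (b ≡ᵇ c) (b ≡ᵇ d))
  (cong₂ _∨_ (≡ᵇ-sym a c) (cong₂ _∨_ (≡ᵇ-sym b c) (cong₂ _∨_ (≡ᵇ-sym a d) (≡ᵇ-sym b d)))))

avoids-swap : ∀ i a b c d → avoids i a b c d ≡ avoids i c d a b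
avoids-swap i a b c d = cong not (∨-swap-halves (i ≡ᵇ a) (i ≡ᵇ b) (i ≡ᵇ c) (i ≡ᵇ d))

U532≡U531ᵀ : ∀ p P Q → U532 p P Q ≡ U531 p Q P
U532≡U531ᵀ p (a , b) (c , d) = cong₂ (λ B z → if B then z else + 0) (disjoint-sym a b c d)
  (ℤΣ.sum-cong (upTo p) (λ i → cong₂ (λ B z → if B then z else + 0) (avoids-swap i a b c d)
     (solve 4 (λ x y z w → x :* z :* w :+ y :* z :* w := z :* w :* x :+ z :* w :* y) refl (S p a i) (S p b i) (S p c i) (S p d i))))
  where open +-*-Solver

-- ‖U‖² ≤ 2 ‖M‖² + 2 ‖E‖² ≤ 2 · 3p² · 8p² + 2 · (16p²)² = 560 p⁴ ≤ (24 p²)², using p + 1 ≤ 2p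
constants≤ℕ : ∀ k → let p = suc k in
  (p ℕ.* suc p ℕ.+ p ℕ.* p) ℕ.* (8 ℕ.* (p ℕ.* p)) ℕ.+ (p ℕ.* suc p ℕ.+ p ℕ.* p) ℕ.* (8 ℕ.* (p ℕ.* p))
    ℕ.+ (16 ℕ.* (p ℕ.* p) ℕ.* (16 ℕ.* (p ℕ.* p)) ℕ.+ 16 ℕ.* (p ℕ.* p) ℕ.* (16 ℕ.* (p ℕ.* p)))
  ≤ 24 ℕ.* (p ℕ.* p) ℕ.* (24 ℕ.* (p ℕ.* p))
constants≤ℕ k = begin
  rx ℕ.* ry ℕ.+ rx ℕ.* ry ℕ.+ (re ℕ.+ re)
    ≤⟨ ℕP.+-monoˡ-≤ (re ℕ.+ re) (ℕP.+-mono-≤ (ℕP.*-monoˡ-≤ ry rx≤3p²) (ℕP.*-monoˡ-≤ ry rx≤3p²)) ⟩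
  3 ℕ.* (p ℕ.* p) ℕ.* ry ℕ.+ 3 ℕ.* (p ℕ.* p) ℕ.* ry ℕ.+ (re ℕ.+ re)
    ≡⟨ solve 1 (λ q → con 3 :* q :* (con 8 :* q) :+ con 3 :* q :* (con 8 :* q) :+ (con 16 :* q :* (con 16 :* q) :+ con 16 :* q :* (con 16 :* q))
                      := con 560 :* (q :* q)) refl (p ℕ.* p) ⟩
  560 ℕ.* (p ℕ.* p ℕ.* (p ℕ.* p))
    ≤⟨ ℕP.*-monoˡ-≤ (p ℕ.* p ℕ.* (p ℕ.* p)) (ℕP.m≤m+n 560 16) ⟩
  576 ℕ.* (p ℕ.* p ℕ.* (p ℕ.* p))
    ≡⟨ solve 1 (λ q → con 576 :* (q :* q) := con 24 :* q :* (con 24 :* q)) refl (p ℕ.* p) ⟩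
  24 ℕ.* (p ℕ.* p) ℕ.* (24 ℕ.* (p ℕ.* p)) ∎
  where
  open ℕP.≤-Reasoning
  open ℕ-Solver
  p = suc k
  rx = p ℕ.* suc p ℕ.+ p ℕ.* p
  ry = 8 ℕ.* (p ℕ.* p)
  re = 16 ℕ.* (p ℕ.* p) ℕ.* (16 ℕ.* (p ℕ.* p))
  rx≤3p² : rx ≤ 3 ℕ.* (p ℕ.* p)
  rx≤3p² = ℕP.≤-trans (ℕP.+-monoˡ-≤ (p ℕ.* p) (ℕP.*-monoʳ-≤ p (ℕ.s≤s (ℕP.m≤n+m (suc k) k))))
             (ℕP.≤-reflexive (solve 1 (λ p → p :* (p :+ p) :+ p :* p := con 3 :* (p :* p)) refl p))

∣*∣≤1 : ∀ {a b} → ℤ.∣ a ∣ ≤ 1 → ℤ.∣ b ∣ ≤ 1 → ℤ.∣ a ℤ.* b ∣ ≤ 1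
∣*∣≤1 {a} {b} a≤1 b≤1 = subst (_≤ 1) (sym (ℤP.abs-* a b)) (ℕP.*-mono-≤ {ℤ.∣ a ∣} {1} {ℤ.∣ b ∣} {1} a≤1 b≤1)

∣Σ<∣≤n : ∀ n (f : ℕ → ℤ) → (∀ i → ℤ.∣ f i ∣ ≤ 1) → ℤ.∣ Σ< n f ∣ ≤ n
∣Σ<∣≤n n f f≤1 = ℕP.≤-trans (∣sum∣≤sum∣∣ f (upTo n))
  (ℕP.≤-trans (Σ<ℕ-mono n (λ i _ → f≤1 i)) (ℕP.≤-reflexive (trans (Σ<ℕ-const n 1) (ℕP.*-identityʳ n))))

module Estimates (k : ℕ) (prime : Prime (suc k)) (p∤2 : ¬ (suc k ℕ∣.∣ 2)) where

  open Congruence k using (p)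
  open LegendreSymbol k using (∣χ∣≤1)
  open Jacobsthal k prime p∤2 using (χ-correlation-rows; χ-correlation-columns)

  ∣S∣≤1 : ∀ a i → ℤ.∣ S p a i ∣ ≤ 1
  ∣S∣≤1 a i = ∣χ∣≤1 (a ℕ.+ p ℕ.∸ i)

  ∣SS∣≤1 : ∀ a i b j → ℤ.∣ S p a i ℤ.* S p b j ∣ ≤ 1
  ∣SS∣≤1 a i b j = ∣*∣≤1 {S p a i} {S p b j} (∣S∣≤1 a i) (∣S∣≤1 b j)

  rowProduct : ℕ → ℕ → ℤ
  rowProduct x y = Σ< p (λ i → S p x i ℤ.* S p y i)

  ∣rowProduct∣≤ : ∀ x y → x < p → y < p → ℤ.∣ rowProduct x y ∣ ≤ 1 ℕ.+ δ x y ℕ.* p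
  ∣rowProduct∣≤ x y x<p y<p with x ℕ.≟ y
  ... | yes refl = subst (λ d → ℤ.∣ rowProduct x x ∣ ≤ 1 ℕ.+ d ℕ.* p) (sym (δ-refl x))
                     (ℕP.≤-trans (∣Σ<∣≤n p (λ i → S p x i ℤ.* S p x i) (λ i → ∣SS∣≤1 x i x i)) (ℕP.≤-trans (ℕP.n≤1+n p) (ℕ.s≤s (ℕP.≤-reflexive (sym (ℕP.*-identityˡ p))))))
  ... | no x≢y   = subst (_≤ 1 ℕ.+ δ x y ℕ.* p) (sym (cong ℤ.∣_∣ (χ-correlation-rows x y x<p y<p x≢y))) (ℕ.s≤s ℕ.z≤n)

  X : Pair → ℕ → ℤ
  X (a , b) i = S p a i ℤ.* S p b i

  ∣gramX∣≤p² : ∀ i j → ℤ.∣ gram (pairs p) X i j ∣ ≤ p ℕ.* p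
  ∣gramX∣≤p² i j = ℕP.≤-trans (∣sum∣≤sum∣∣ (λ Q → X Q i ℤ.* X Q j) (pairs p))
    (ℕP.≤-trans (ℕΣ-mono (All.universal (λ Q → ∣*∣≤1 {X Q i} {X Q j} (∣X∣≤1 Q i) (∣X∣≤1 Q j)) (pairs p))) (count-pairs p))
    where
    ∣X∣≤1 : ∀ Q i → ℤ.∣ X Q i ∣ ≤ 1
    ∣X∣≤1 (a , b) i = ∣SS∣≤1 a i b i

  module _ (i j : ℕ) where

    private
      g : ℕ → ℤ
      g a = S p a i ℤ.* S p a j

    gramX≡cross : gram (pairs p) X i j ≡ Σ< p (λ b → Σ< b (λ a → g a ℤ.* g b))
    gramX≡cross = trans (ℤΣ-pairs p (λ Q → X Q i ℤ.* X Q j))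
      (Σ<-cong p (λ b _ → Σ<-cong b (λ a _ → solve 4 (λ x y z w → (x :* y) :* (z :* w) := (x :* z) :* (y :* w)) refl
         (S p a i) (S p b i) (S p a j) (S p b j))))
      where open +-*-Solver

    -- off the diagonal Σ g = −1, so twice the Gram entry is (Σ g)² − Σ g² = 1 − Σ g²
    2*gramX≡1-squares : i < p → j < p → i ≢ j → + 2 ℤ.* gram (pairs p) X i j ≡ + 1 ℤ.- Σ< p (λ a → g a ℤ.* g a)
    2*gramX≡1-squares i<p j<p i≢j = begin
      + 2 ℤ.* G                                    ≡⟨ solve 2 (λ t q → con (+ 2) :* t := (t :+ t :+ q) :- q) refl G squares ⟩
      (G ℤ.+ G ℤ.+ squares) ℤ.- squares            ≡⟨ cong (λ t → (t ℤ.+ t ℤ.+ squares) ℤ.- squares) gramX≡cross ⟩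
      (C ℤ.+ C ℤ.+ squares) ℤ.- squares            ≡⟨ cong (ℤ._- squares) (square-of-Σ< g p) ⟩
      Σ< p g ℤ.* Σ< p g ℤ.- squares                ≡⟨ cong (λ s → s ℤ.* s ℤ.- squares) (χ-correlation-columns i j i<p j<p i≢j) ⟩
      + 1 ℤ.- squares                              ∎
      where
      open ≡-Reasoning
      open +-*-Solver
      G = gram (pairs p) X i j
      C = Σ< p (λ b → Σ< b (λ a → g a ℤ.* g b))
      squares = Σ< p (λ a → g a ℤ.* g a)

    ∣gramX∣≤p+1 : i < p → j < p → i ≢ j → ℤ.∣ gram (pairs p) X i j ∣ ≤ suc p
    ∣gramX∣≤p+1 i<p j<p i≢j = begin
      ℤ.∣ G ∣                         ≤⟨ ℕP.m≤m+n ℤ.∣ G ∣ (ℤ.∣ G ∣ ℕ.+ 0) ⟩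
      2 ℕ.* ℤ.∣ G ∣                   ≡⟨ ℤP.abs-* (+ 2) G ⟨
      ℤ.∣ + 2 ℤ.* G ∣                 ≡⟨ cong ℤ.∣_∣ (2*gramX≡1-squares i<p j<p i≢j) ⟩
      ℤ.∣ + 1 ℤ.- squares ∣           ≤⟨ ℤP.∣i-j∣≤∣i∣+∣j∣ (+ 1) squares ⟩
      1 ℕ.+ ℤ.∣ squares ∣             ≤⟨ ℕ.s≤s (∣Σ<∣≤n p (λ a → g a ℤ.* g a) (λ a → ∣*∣≤1 {g a} {g a} (∣SS∣≤1 a i a j) (∣SS∣≤1 a i a j))) ⟩
      suc p                           ∎
      where
      open ℕP.≤-Reasoning
      G = gram (pairs p) X i j
      squares = Σ< p (λ a → g a ℤ.* g a)

  ∣gramX∣≤ : ∀ i j → i < p → j < p → ℤ.∣ gram (pairs p) X i j ∣ ≤ suc p ℕ.+ δ i j ℕ.* (p ℕ.* p)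
  ∣gramX∣≤ i j i<p j<p with i ℕ.≟ j
  ... | yes refl = subst (λ d → ℤ.∣ gram (pairs p) X i i ∣ ≤ suc p ℕ.+ d ℕ.* (p ℕ.* p)) (sym (δ-refl i))
                     (ℕP.≤-trans (∣gramX∣≤p² i i) (ℕP.≤-trans (ℕP.≤-reflexive (sym (ℕP.*-identityˡ (p ℕ.* p)))) (ℕP.m≤n+m _ (suc p))))
  ... | no i≢j   = ℕP.≤-trans (∣gramX∣≤p+1 i j i<p j<p i≢j) (ℕP.m≤m+n (suc p) _)

  boundX : SqNormBound (pairs p) (upTo p) X (toℚ (+ (p ℕ.* suc p ℕ.+ p ℕ.* p)))
  boundX = gram-rowSum-bound (pairs p) (upTo p) X _ (All.tabulate λ {i} i∈ → begin
    Σ<ℕ p (λ j → ℤ.∣ gram (pairs p) X i j ∣)          ≤⟨ Σ<ℕ-mono p (λ j j<p → ∣gramX∣≤ i j (∈-upTo⁻ i∈) j<p) ⟩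
    Σ<ℕ p (λ j → suc p ℕ.+ δ i j ℕ.* (p ℕ.* p))       ≡⟨ ℕΣ.sum-+ (λ _ → suc p) (λ j → δ i j ℕ.* (p ℕ.* p)) (upTo p) ⟩
    Σ<ℕ p (λ _ → suc p) ℕ.+ Σ<ℕ p (λ j → δ i j ℕ.* (p ℕ.* p))
      ≡⟨ cong₂ ℕ._+_ (Σ<ℕ-const p (suc p)) (sym (ℕΣ.sum-*ʳ (p ℕ.* p) (δ i) (upTo p))) ⟩
    p ℕ.* suc p ℕ.+ Σ<ℕ p (δ i) ℕ.* (p ℕ.* p)         ≤⟨ ℕP.+-monoʳ-≤ (p ℕ.* suc p) (ℕP.*-monoˡ-≤ (p ℕ.* p) (Σ<ℕ-δ≤1 p i)) ⟩
    p ℕ.* suc p ℕ.+ 1 ℕ.* (p ℕ.* p)                   ≡⟨ cong (λ t → p ℕ.* suc p ℕ.+ t) (ℕP.*-identityˡ (p ℕ.* p)) ⟩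
    p ℕ.* suc p ℕ.+ p ℕ.* p                           ∎)
    where open ℕP.≤-Reasoning

  touching : Pair → Pair → ℕ
  touching (a , b) (c , d) = δ a c ℕ.+ δ a d ℕ.+ δ b c ℕ.+ δ b d

  Σ-touching≤4p : ∀ P → ℕΣ.sum (touching P) (pairs p) ≤ 4 ℕ.* p
  Σ-touching≤4p (a , b) = begin
    ℕΣ.sum (touching (a , b)) (pairs p)
      ≡⟨ trans (ℕΣ.sum-+ (λ Q → δ a (proj₁ Q) ℕ.+ δ a (proj₂ Q) ℕ.+ δ b (proj₁ Q)) (λ Q → δ b (proj₂ Q)) (pairs p))
               (cong (ℕ._+ Σ-snd b) (trans (ℕΣ.sum-+ (λ Q → δ a (proj₁ Q) ℕ.+ δ a (proj₂ Q)) (λ Q → δ b (proj₁ Q)) (pairs p))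
                 (cong (ℕ._+ Σ-fst b) (ℕΣ.sum-+ (λ Q → δ a (proj₁ Q)) (λ Q → δ a (proj₂ Q)) (pairs p))))) ⟩
    Σ-fst a ℕ.+ Σ-snd a ℕ.+ Σ-fst b ℕ.+ Σ-snd b
      ≤⟨ ℕP.+-mono-≤ (ℕP.+-mono-≤ (ℕP.+-mono-≤ (count-pairs-fst p a) (count-pairs-snd p a)) (count-pairs-fst p b)) (count-pairs-snd p b) ⟩
    p ℕ.+ p ℕ.+ p ℕ.+ p
      ≡⟨ solve 1 (λ p → p :+ p :+ p :+ p := con 4 :* p) refl p ⟩
    4 ℕ.* p ∎
    where
    open ℕP.≤-Reasoning
    open ℕ-Solver
    Σ-fst Σ-snd : ℕ → ℕ
    Σ-fst x = ℕΣ.sum (λ Q → δ x (proj₁ Q)) (pairs p)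
    Σ-snd x = ℕΣ.sum (λ Q → δ x (proj₂ Q)) (pairs p)

  Σ-const+touching : ∀ P (m w : ℕ) → ℕΣ.sum (λ Q → m ℕ.+ touching P Q ℕ.* w) (pairs p) ≤ m ℕ.* (p ℕ.* p) ℕ.+ 4 ℕ.* p ℕ.* w
  Σ-const+touching P m w = begin
    ℕΣ.sum (λ Q → m ℕ.+ touching P Q ℕ.* w) (pairs p)
      ≡⟨ ℕΣ.sum-+ (λ _ → m) (λ Q → touching P Q ℕ.* w) (pairs p) ⟩
    ℕΣ.sum (λ _ → m) (pairs p) ℕ.+ ℕΣ.sum (λ Q → touching P Q ℕ.* w) (pairs p)
      ≡⟨ cong₂ ℕ._+_ (trans (ℕΣ.sum-cong (pairs p) (λ _ → sym (ℕP.*-identityʳ m))) (sym (ℕΣ.sum-*ˡ m (λ _ → 1) (pairs p))))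
                     (sym (ℕΣ.sum-*ʳ w (touching P) (pairs p))) ⟩
    m ℕ.* ℕΣ.sum (λ _ → 1) (pairs p) ℕ.+ ℕΣ.sum (touching P) (pairs p) ℕ.* w
      ≤⟨ ℕP.+-mono-≤ (ℕP.*-monoʳ-≤ m (count-pairs p)) (ℕP.*-monoˡ-≤ w (Σ-touching≤4p P)) ⟩
    m ℕ.* (p ℕ.* p) ℕ.+ 4 ℕ.* p ℕ.* w ∎
    where open ℕP.≤-Reasoning

  Y : ℕ → Pair → ℤ
  Y i (c , d) = S p c i ℤ.+ S p d i

  gramY≡ : ∀ c d c′ d′ → gram (upTo p) Y (c , d) (c′ , d′)
           ≡ rowProduct c c′ ℤ.+ rowProduct c d′ ℤ.+ rowProduct d c′ ℤ.+ rowProduct d d′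
  gramY≡ c d c′ d′ = begin
    ℤΣ.sum (λ i → Y i (c , d) ℤ.* Y i (c′ , d′)) (upTo p)
      ≡⟨ ℤΣ.sum-cong (upTo p) (λ i → solve 4 (λ a b x y → (a :+ b) :* (x :+ y) := a :* x :+ a :* y :+ b :* x :+ b :* y) refl
           (S p c i) (S p d i) (S p c′ i) (S p d′ i)) ⟩
    ℤΣ.sum (λ i → cc′ i ℤ.+ cd′ i ℤ.+ dc′ i ℤ.+ dd′ i) (upTo p)
      ≡⟨ trans (ℤΣ.sum-+ (λ i → cc′ i ℤ.+ cd′ i ℤ.+ dc′ i) dd′ (upTo p))
           (cong (ℤ._+ Σ< p dd′) (trans (ℤΣ.sum-+ (λ i → cc′ i ℤ.+ cd′ i) dc′ (upTo p))
             (cong (ℤ._+ Σ< p dc′) (ℤΣ.sum-+ cc′ cd′ (upTo p))))) ⟩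
    rowProduct c c′ ℤ.+ rowProduct c d′ ℤ.+ rowProduct d c′ ℤ.+ rowProduct d d′ ∎
    where
    open ≡-Reasoning
    open +-*-Solver
    cc′ cd′ dc′ dd′ : ℕ → ℤ
    cc′ i = S p c i ℤ.* S p c′ i
    cd′ i = S p c i ℤ.* S p d′ i
    dc′ i = S p d i ℤ.* S p c′ i
    dd′ i = S p d i ℤ.* S p d′ i

  ∣gramY∣≤ : ∀ c d c′ d′ → c < p → d < p → c′ < p → d′ < p →
             ℤ.∣ gram (upTo p) Y (c , d) (c′ , d′) ∣ ≤ 4 ℕ.+ touching (c , d) (c′ , d′) ℕ.* p
  ∣gramY∣≤ c d c′ d′ c<p d<p c′<p d′<p = begin
    ℤ.∣ gram (upTo p) Y (c , d) (c′ , d′) ∣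
      ≡⟨ cong ℤ.∣_∣ (gramY≡ c d c′ d′) ⟩
    ℤ.∣ rowProduct c c′ ℤ.+ rowProduct c d′ ℤ.+ rowProduct d c′ ℤ.+ rowProduct d d′ ∣
      ≤⟨ ∣+∣≤ (rowProduct c c′) (rowProduct c d′) (rowProduct d c′) (rowProduct d d′) ⟩
    ℤ.∣ rowProduct c c′ ∣ ℕ.+ ℤ.∣ rowProduct c d′ ∣ ℕ.+ ℤ.∣ rowProduct d c′ ∣ ℕ.+ ℤ.∣ rowProduct d d′ ∣
      ≤⟨ ℕP.+-mono-≤ (ℕP.+-mono-≤ (ℕP.+-mono-≤ (∣rowProduct∣≤ c c′ c<p c′<p) (∣rowProduct∣≤ c d′ c<p d′<p))
                                  (∣rowProduct∣≤ d c′ d<p c′<p)) (∣rowProduct∣≤ d d′ d<p d′<p) ⟩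
    (1 ℕ.+ δ c c′ ℕ.* p) ℕ.+ (1 ℕ.+ δ c d′ ℕ.* p) ℕ.+ (1 ℕ.+ δ d c′ ℕ.* p) ℕ.+ (1 ℕ.+ δ d d′ ℕ.* p)
      ≡⟨ solve 5 (λ a b e f p → (con 1 :+ a :* p) :+ (con 1 :+ b :* p) :+ (con 1 :+ e :* p) :+ (con 1 :+ f :* p)
                                := con 4 :+ (a :+ b :+ e :+ f) :* p) refl (δ c c′) (δ c d′) (δ d c′) (δ d d′) p ⟩
    4 ℕ.+ touching (c , d) (c′ , d′) ℕ.* p ∎
    where
    open ℕP.≤-Reasoning
    open ℕ-Solver
    ∣+∣≤ : ∀ a b e f → ℤ.∣ a ℤ.+ b ℤ.+ e ℤ.+ f ∣ ≤ ℤ.∣ a ∣ ℕ.+ ℤ.∣ b ∣ ℕ.+ ℤ.∣ e ∣ ℕ.+ ℤ.∣ f ∣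
    ∣+∣≤ a b e f = ℕP.≤-trans (ℤP.∣i+j∣≤∣i∣+∣j∣ (a ℤ.+ b ℤ.+ e) f) (ℕP.+-monoˡ-≤ ℤ.∣ f ∣
                     (ℕP.≤-trans (ℤP.∣i+j∣≤∣i∣+∣j∣ (a ℤ.+ b) e) (ℕP.+-monoˡ-≤ ℤ.∣ e ∣ (ℤP.∣i+j∣≤∣i∣+∣j∣ a b))))

  boundY : SqNormBound (upTo p) (pairs p) Y (toℚ (+ (8 ℕ.* (p ℕ.* p))))
  boundY = gram-rowSum-bound (upTo p) (pairs p) Y _ (All-pairs p λ c d c<d d<p → begin
    ℕΣ.sum (λ Q → ℤ.∣ gram (upTo p) Y (c , d) Q ∣) (pairs p)
      ≤⟨ ℕΣ-mono (All-pairs p (λ c′ d′ c′<d′ d′<p → ∣gramY∣≤ c d c′ d′ (ℕP.<-trans c<d d<p) d<p (ℕP.<-trans c′<d′ d′<p) d′<p)) ⟩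
    ℕΣ.sum (λ Q → 4 ℕ.+ touching (c , d) Q ℕ.* p) (pairs p)
      ≤⟨ Σ-const+touching (c , d) 4 p ⟩
    4 ℕ.* (p ℕ.* p) ℕ.+ 4 ℕ.* p ℕ.* p
      ≡⟨ solve 1 (λ p → con 4 :* (p :* p) :+ con 4 :* p :* p := con 8 :* (p :* p)) refl p ⟩
    8 ℕ.* (p ℕ.* p) ∎)
    where
    open ℕP.≤-Reasoning
    open ℕ-Solver

  M : Pair → Pair → ℤ
  M = matMul (upTo p) X Y

  boundM : SqNormBound (pairs p) (pairs p) M (toℚ (+ (p ℕ.* suc p ℕ.+ p ℕ.* p)) ℚ.* toℚ (+ (8 ℕ.* (p ℕ.* p))))
  boundM = SqNormBound-matMul (pairs p) (pairs p) (upTo p) X Y (toℚ-nonNeg (p ℕ.* suc p ℕ.+ p ℕ.* p)) boundX boundY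

  ∣XY∣≤2 : ∀ P Q i → ℤ.∣ X P i ℤ.* Y i Q ∣ ≤ 2
  ∣XY∣≤2 (a , b) (c , d) i = subst (_≤ 2) (sym (ℤP.abs-* (X (a , b) i) (Y i (c , d))))
    (ℕP.*-mono-≤ {ℤ.∣ X (a , b) i ∣} {1} {ℤ.∣ Y i (c , d) ∣} {2} (∣SS∣≤1 a i b i)
      (ℕP.≤-trans (ℤP.∣i+j∣≤∣i∣+∣j∣ (S p c i) (S p d i)) (ℕP.+-mono-≤ (∣S∣≤1 c i) (∣S∣≤1 d i))))

  ∣M∣≤2p : ∀ P Q → ℤ.∣ M P Q ∣ ≤ 2 ℕ.* p
  ∣M∣≤2p P Q = ℕP.≤-trans (∣sum∣≤sum∣∣ (λ i → X P i ℤ.* Y i Q) (upTo p))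
    (ℕP.≤-trans (Σ<ℕ-mono p (λ i _ → ∣XY∣≤2 P Q i)) (ℕP.≤-reflexive (trans (Σ<ℕ-const p 2) (ℕP.*-comm p 2))))

  any4≤ : ∀ x y z w → (if not (x ∨ y ∨ z ∨ w) then 0 else 1)
                      ≤ (if x then 1 else 0) ℕ.+ (if y then 1 else 0) ℕ.+ (if z then 1 else 0) ℕ.+ (if w then 1 else 0)
  any4≤ true  y     z     w     = ℕ.s≤s ℕ.z≤n
  any4≤ false true  z     w     = ℕ.s≤s ℕ.z≤n
  any4≤ false false true  w     = ℕ.s≤s ℕ.z≤n
  any4≤ false false false true  = ℕ.s≤s ℕ.z≤n
  any4≤ false false false false = ℕ.z≤n

  touching-sym : ∀ P Q → touching P Q ≡ touching Q P
  touching-sym (a , b) (c , d) rewrite δ-sym a c | δ-sym a d | δ-sym b c | δ-sym b d =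
    solve 4 (λ x y z w → x :+ y :+ z :+ w := x :+ z :+ y :+ w) refl (δ c a) (δ d a) (δ c b) (δ d b)
    where open ℕ-Solver

  E : Pair → Pair → ℤ
  E P Q = U531 p P Q ℤ.- M P Q

  ∣E∣≤ : ∀ P Q → ℤ.∣ E P Q ∣ ≤ 8 ℕ.+ touching P Q ℕ.* (2 ℕ.* p)
  ∣E∣≤ (a , b) (c , d) with disjoint (a , b) (c , d) | any4≤ (a ≡ᵇ c) (a ≡ᵇ d) (b ≡ᵇ c) (b ≡ᵇ d)
  ... | false | shared = begin
    ℤ.∣ + 0 ℤ.- M (a , b) (c , d) ∣   ≡⟨ cong ℤ.∣_∣ (ℤP.+-identityˡ (ℤ.- M (a , b) (c , d))) ⟩
    ℤ.∣ ℤ.- M (a , b) (c , d) ∣       ≡⟨ ℤP.∣-i∣≡∣i∣ (M (a , b) (c , d)) ⟩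
    ℤ.∣ M (a , b) (c , d) ∣           ≤⟨ ∣M∣≤2p (a , b) (c , d) ⟩
    2 ℕ.* p                           ≤⟨ ℕP.≤-trans (ℕP.≤-reflexive (sym (ℕP.*-identityˡ (2 ℕ.* p)))) (ℕP.*-monoˡ-≤ (2 ℕ.* p) shared) ⟩
    touching (a , b) (c , d) ℕ.* (2 ℕ.* p)  ≤⟨ ℕP.m≤n+m _ 8 ⟩
    8 ℕ.+ touching (a , b) (c , d) ℕ.* (2 ℕ.* p) ∎
    where open ℕP.≤-Reasoning
  ... | true | _ = ℕP.≤-trans (∣sumAvoiding-M∣≤8) (ℕP.m≤m+n 8 _)
    where
    open ℕP.≤-Reasoning
    F : ℕ → ℤ
    F i = S p a i ℤ.* S p b i ℤ.* S p c i ℤ.+ S p a i ℤ.* S p b i ℤ.* S p d i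
    missing : ℕ → ℕ
    missing i = δ i a ℕ.+ δ i b ℕ.+ δ i c ℕ.+ δ i d
    term : ℕ → ℤ
    term i = (if avoids i a b c d then F i else + 0) ℤ.- X (a , b) i ℤ.* Y i (c , d)
    ∣term∣≤ : ∀ i → ℤ.∣ term i ∣ ≤ 2 ℕ.* missing i
    ∣term∣≤ i with avoids i a b c d | any4≤ (i ≡ᵇ a) (i ≡ᵇ b) (i ≡ᵇ c) (i ≡ᵇ d)
    ... | true  | _ = ℕP.≤-trans (ℕP.≤-reflexive (cong ℤ.∣_∣ (trans (cong (ℤ._- X (a , b) i ℤ.* Y i (c , d)) F≡XY)
                        (ℤP.+-inverseʳ (X (a , b) i ℤ.* Y i (c , d)))))) ℕ.z≤n
      where
      open +-*-Solver
      F≡XY : F i ≡ X (a , b) i ℤ.* Y i (c , d)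
      F≡XY = solve 4 (λ x y z w → x :* y :* z :+ x :* y :* w := (x :* y) :* (z :+ w)) refl (S p a i) (S p b i) (S p c i) (S p d i)
    ... | false | hit = begin
      ℤ.∣ + 0 ℤ.- X (a , b) i ℤ.* Y i (c , d) ∣ ≡⟨ trans (cong ℤ.∣_∣ (ℤP.+-identityˡ (ℤ.- (X (a , b) i ℤ.* Y i (c , d))))) (ℤP.∣-i∣≡∣i∣ (X (a , b) i ℤ.* Y i (c , d))) ⟩
      ℤ.∣ X (a , b) i ℤ.* Y i (c , d) ∣         ≤⟨ ∣XY∣≤2 (a , b) (c , d) i ⟩
      2 ℕ.* 1                                    ≤⟨ ℕP.*-monoʳ-≤ 2 hit ⟩
      2 ℕ.* missing i                            ∎
    Σ<-missing≤4 : Σ<ℕ p missing ≤ 4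
    Σ<-missing≤4 = begin
      Σ<ℕ p missing
        ≡⟨ trans (ℕΣ.sum-+ (λ i → δ i a ℕ.+ δ i b ℕ.+ δ i c) (λ i → δ i d) (upTo p))
                 (cong (ℕ._+ Σ<ℕ p (λ i → δ i d)) (trans (ℕΣ.sum-+ (λ i → δ i a ℕ.+ δ i b) (λ i → δ i c) (upTo p))
                   (cong (ℕ._+ Σ<ℕ p (λ i → δ i c)) (ℕΣ.sum-+ (λ i → δ i a) (λ i → δ i b) (upTo p))))) ⟩
      Σ<ℕ p (λ i → δ i a) ℕ.+ Σ<ℕ p (λ i → δ i b) ℕ.+ Σ<ℕ p (λ i → δ i c) ℕ.+ Σ<ℕ p (λ i → δ i d)
        ≤⟨ ℕP.+-mono-≤ (ℕP.+-mono-≤ (ℕP.+-mono-≤ (Σδ≤1 a) (Σδ≤1 b)) (Σδ≤1 c)) (Σδ≤1 d) ⟩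
      4 ∎
      where
      Σδ≤1 : ∀ r → Σ<ℕ p (λ i → δ i r) ≤ 1
      Σδ≤1 r = subst (_≤ 1) (ℕΣ.sum-cong (upTo p) (λ i → δ-sym r i)) (Σ<ℕ-δ≤1 p r)
    ∣sumAvoiding-M∣≤8 : ℤ.∣ sumAvoiding p a b c d F ℤ.- M (a , b) (c , d) ∣ ≤ 8
    ∣sumAvoiding-M∣≤8 = begin
      ℤ.∣ sumAvoiding p a b c d F ℤ.- M (a , b) (c , d) ∣
        ≡⟨ cong ℤ.∣_∣ (sym (Σ<-difference p (λ i → if avoids i a b c d then F i else + 0) (λ i → X (a , b) i ℤ.* Y i (c , d)))) ⟩
      ℤ.∣ Σ< p term ∣         ≤⟨ ∣sum∣≤sum∣∣ term (upTo p) ⟩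
      Σ<ℕ p (λ i → ℤ.∣ term i ∣) ≤⟨ Σ<ℕ-mono p (λ i _ → ∣term∣≤ i) ⟩
      Σ<ℕ p (λ i → 2 ℕ.* missing i) ≡⟨ ℕΣ.sum-*ˡ 2 missing (upTo p) ⟨
      2 ℕ.* Σ<ℕ p missing      ≤⟨ ℕP.*-monoʳ-≤ 2 Σ<-missing≤4 ⟩
      8 ∎

  boundE : SqNormBound (pairs p) (pairs p) E (toℚ (+ (16 ℕ.* (p ℕ.* p) ℕ.* (16 ℕ.* (p ℕ.* p)))))
  boundE = gram-rowSum-bound (pairs p) (pairs p) E _
    (schur-gram-rowSum (pairs p) (pairs p) E B (16 ℕ.* (p ℕ.* p)) (16 ℕ.* (p ℕ.* p)) (λ {P} {Q} _ _ → ∣E∣≤ P Q) (λ {P} _ → rows P) (λ {Q} _ → columns Q))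
    where
    B : Pair → Pair → ℕ
    B P Q = 8 ℕ.+ touching P Q ℕ.* (2 ℕ.* p)
    rows : ∀ P → ℕΣ.sum (B P) (pairs p) ≤ 16 ℕ.* (p ℕ.* p)
    rows P = ℕP.≤-trans (Σ-const+touching P 8 (2 ℕ.* p))
      (ℕP.≤-reflexive (solve 1 (λ p → con 8 :* (p :* p) :+ con 4 :* p :* (con 2 :* p) := con 16 :* (p :* p)) refl p))
      where open ℕ-Solver
    columns : ∀ Q → ℕΣ.sum (λ P → B P Q) (pairs p) ≤ 16 ℕ.* (p ℕ.* p)
    columns Q = subst (_≤ 16 ℕ.* (p ℕ.* p)) (ℕΣ.sum-cong (pairs p) (λ P → cong (λ t → 8 ℕ.+ t ℕ.* (2 ℕ.* p)) (touching-sym Q P))) (rows Q)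

  bound531 : SqNormBound (pairs p) (pairs p) (U531 p) (toℚ (+ (24 ℕ.* (p ℕ.* p) ℕ.* (24 ℕ.* (p ℕ.* p)))))
  bound531 = SqNormBound-mono (pairs p) (pairs p) constants≤
    (SqNormBound-cong (pairs p) (pairs p) M+E≡U (SqNormBound-+ (pairs p) (pairs p) boundM boundE))
    where
    rx = p ℕ.* suc p ℕ.+ p ℕ.* p
    ry = 8 ℕ.* (p ℕ.* p)
    re = 16 ℕ.* (p ℕ.* p) ℕ.* (16 ℕ.* (p ℕ.* p))
    M+E≡U : ∀ P Q → M P Q ℤ.+ E P Q ≡ U531 p P Q
    M+E≡U P Q = solve 2 (λ m u → m :+ (u :- m) := u) refl (M P Q) (U531 p P Q)
      where open +-*-Solver
    toℚ-+ℕ : ∀ m n → toℚ (+ (m ℕ.+ n)) ≡ toℚ (+ m) ℚ.+ toℚ (+ n)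
    toℚ-+ℕ m n = trans (cong toℚ (ℤP.pos-+ m n)) (toℚ-+ (+ m) (+ n))
    constants≤ : (toℚ (+ rx) ℚ.* toℚ (+ ry) ℚ.+ toℚ (+ rx) ℚ.* toℚ (+ ry)) ℚ.+ (toℚ (+ re) ℚ.+ toℚ (+ re))
                 ℚ.≤ toℚ (+ (24 ℕ.* (p ℕ.* p) ℕ.* (24 ℕ.* (p ℕ.* p))))
    constants≤ = subst (ℚ._≤ toℚ (+ (24 ℕ.* (p ℕ.* p) ℕ.* (24 ℕ.* (p ℕ.* p)))))
      (trans (toℚ-+ℕ (rx ℕ.* ry ℕ.+ rx ℕ.* ry) (re ℕ.+ re))
        (cong₂ ℚ._+_ (trans (toℚ-+ℕ (rx ℕ.* ry) (rx ℕ.* ry)) (cong₂ ℚ._+_ (toℚ-*ℕ rx ry) (toℚ-*ℕ rx ry))) (toℚ-+ℕ re re)))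
      (toℚ-mono-≤ {+ _} {+ _} (ℤ.+≤+ (constants≤ℕ k)))
      where
      toℚ-*ℕ : ∀ m n → toℚ (+ (m ℕ.* n)) ≡ toℚ (+ m) ℚ.* toℚ (+ n)
      toℚ-*ℕ m n = trans (cong toℚ (ℤP.pos-* m n)) (toℚ-* (+ m) (+ n))

  bound532 : SqNormBound (pairs p) (pairs p) (U532 p) (toℚ (+ (24 ℕ.* (p ℕ.* p) ℕ.* (24 ℕ.* (p ℕ.* p)))))
  bound532 = SqNormBound-cong (pairs p) (pairs p) (λ P Q → sym (U532≡U531ᵀ p P Q))
    (SqNormBound-transpose (pairs p) (pairs p) _ {{toℚ-pos (ℕ.pred (24 ℕ.* (p ℕ.* p) ℕ.* (24 ℕ.* (p ℕ.* p))))}} bound531)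

-- p ≡ 1 (mod 4) is only used through p being odd
prime≡1mod4⇒odd : ∀ k → Prime (suc k) → suc k ℕ.% 4 ≡ 1 → ¬ (suc k ℕ∣.∣ 2)
prime≡1mod4⇒odd zero          pr _  _   = ¬prime[1] pr
prime≡1mod4⇒odd (suc zero)    _  () _
prime≡1mod4⇒odd (suc (suc k)) _  _  p∣2 with ℕ∣.∣⇒≤ p∣2
... | ℕ.s≤s (ℕ.s≤s ())

-- opNormBound p U K is sqNorm-act≤ of SqNormBound (pairs p) (pairs p) U (K²), definitionally
BigOp²-fromOddPrimes : ∀ U → (∀ k → Prime (suc k) → ¬ (suc k ℕ∣.∣ 2) →
  SqNormBound (pairs (suc k)) (pairs (suc k)) (U (suc k)) (toℚ (+ (24 ℕ.* (suc k ℕ.* suc k) ℕ.* (24 ℕ.* (suc k ℕ.* suc k)))))) →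
  BigOp² U
BigOp²-fromOddPrimes U bound = 24 , 0 , λ where
  zero    pr _   _ → ⊥-elim (¬prime[0] pr)
  (suc k) pr p≡1 _ → SqNormBound.sqNorm-act≤ (bound k pr (prime≡1mod4⇒odd k pr p≡1))

proposition3p31 : BigOp² U531 × BigOp² U532
proposition3p31 = BigOp²-fromOddPrimes U531 Estimates.bound531 , BigOp²-fromOddPrimes U532 Estimates.bound532
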